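{- Let $G_0$ be a connected graph and $e=uv$ an edge of $G_0$. Let $G$ be obtained from $G_0$ by annelating a $6$-cycle over $e$, i.e. by adding four new vertices $p,q,r,s$ and the five new edges $up,pq,qr,rs,sv$ (so that $u,p,q,r,s,v$ form a new $6$-cycle containing $e$). Then \begin{eqnarray*} H_e(G,x) & = & H_e(G_0,x) + (x+x^2)H_e(G_0,u,x) + (x+x^2)H_e(G_0,v,x) \\ & & + x^2H_e(G_0,e,x) + 5 + 4x + 3x^2 + 3x^3. \end{eqnarray*}
   Context: For a connected graph $G$, the distance $d(e,f)$ between edges $e,f$ is their distance as vertices of the line graph $L(G)$; the distance between a vertex $w$ and an edge $e=uv$ is $d(w,e)=\min\{d(w,u),d(w,v)\}$ (usual shortest-path distance). Let $d(G,k)$ be the number of unordered pairs of (not necessarily distinct) edges at distance $k$ (so $d(G,0)=|E(G)|$), and $H_e(G,x)=\sum_{k\ge0}d(G,k)x^k$. For a vertex $w$, let $d(G,w,k)$ be the number of edges of $G$ at distance $k$ from $w$ (so $d(G,w,0)=\deg(w)$) and $H_e(G,w,x)=\sum_{k\ge0}d(G,w,k)x^k$. For an edge $e$, let $d(G,e,k)$ be the number of edges $f$ of $G$ with $d(e,f)=k$ (so $d(G,e,0)=1$) and $H_e(G,e,x)=\sum_{k\ge0}d(G,e,k)x^k$. -}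

module Defs where

open import Data.Nat using (ℕ; zero; suc; _+_; _∸_; _≡ᵇ_; _<ᵇ_; _≤ᵇ_; _⊔_; _⊓_)
open import Data.Bool using (Bool; true; false; _∧_; _∨_; not; if_then_else_)
open import Data.Fin using (Fin; toℕ; splitAt)
open import Data.Sum using (inj₁; inj₂)
open import Data.Product using (_×_; _,_; proj₁; proj₂; ∃)
open import Data.List using (List; []; _∷_; length; lookup; allFin; concatMap; filterᵇ)
open import Data.Bool.ListAction using (any)
open import Relation.Binary.PropositionalEquality using (_≡_)

record Graph : Set where
  field
    N   : ℕ
    adj : Fin N → Fin N → Bool
open Graph public

_=ᶠ_ : ∀ {n} → Fin n → Fin n → Bool
i =ᶠ j = toℕ i ≡ᵇ toℕ j

IsSimple : Graph → Set
IsSimple G = (∀ a b → adj G a b ≡ adj G b a) × (∀ a → adj G a a ≡ false)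

reach : (G : Graph) → ℕ → Fin (N G) → Fin (N G) → Bool
reach G zero    a b = a =ᶠ b
reach G (suc k) a b = reach G k a b ∨ any (λ c → adj G a c ∧ reach G k c b) (allFin (N G))

Connected : Graph → Set
Connected G = ∀ a b → ∃ λ k → reach G k a b ≡ true

-- least k ≤ bound with p k (returns bound if none)
search : (ℕ → Bool) → ℕ → ℕ
search p zero    = zero
search p (suc b) = if p zero then zero else suc (search (λ k → p (suc k)) b)

-- shortest-path distance (in a connected graph every distance is < N)
dist : (G : Graph) → Fin (N G) → Fin (N G) → ℕ
dist G a b = search (λ k → reach G k a b) (N G)

edges : (G : Graph) → List (Fin (N G) × Fin (N G))
edges G = concatMap (λ i → concatMap (λ j →
            if (toℕ i <ᵇ toℕ j) ∧ adj G i j then (i , j) ∷ [] else [])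
            (allFin (N G))) (allFin (N G))

Edge : Graph → Set
Edge G = Fin (length (edges G))

endpoints : (G : Graph) → Edge G → Fin (N G) × Fin (N G)
endpoints G e = lookup (edges G) e

shareEnd : ∀ {n} → Fin n × Fin n → Fin n × Fin n → Bool
shareEnd (a , b) (c , d) = (a =ᶠ c) ∨ (a =ᶠ d) ∨ (b =ᶠ c) ∨ (b =ᶠ d)

lineGraph : Graph → Graph
lineGraph G = record
  { N   = length (edges G)
  ; adj = λ e f → not (e =ᶠ f) ∧ shareEnd (endpoints G e) (endpoints G f) }

edgeDist : (G : Graph) → Edge G → Edge G → ℕ
edgeDist G e f = dist (lineGraph G) e f

vertEdgeDist : (G : Graph) → Fin (N G) → Edge G → ℕ
vertEdgeDist G w e = dist G w (proj₁ (endpoints G e)) ⊓ dist G w (proj₂ (endpoints G e))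

count : ∀ {A : Set} → (A → Bool) → List A → ℕ
count p xs = length (filterᵇ p xs)

-- unordered pairs {e,f} (e = f allowed) as pairs (e , f) with index e ≤ index f
edgePairs : (G : Graph) → List (Edge G × Edge G)
edgePairs G = concatMap (λ e → concatMap (λ f →
                if toℕ e ≤ᵇ toℕ f then (e , f) ∷ [] else [])
                (allFin (length (edges G)))) (allFin (length (edges G)))

Poly : Set
Poly = ℕ → ℕ

He : Graph → Poly
He G k = count (λ ef → edgeDist G (proj₁ ef) (proj₂ ef) ≡ᵇ k) (edgePairs G)

HeV : (G : Graph) → Fin (N G) → Poly
HeV G w k = count (λ f → vertEdgeDist G w f ≡ᵇ k) (allFin (length (edges G)))

HeE : (G : Graph) → Edge G → Poly
HeE G e k = count (λ f → edgeDist G e f ≡ᵇ k) (allFin (length (edges G)))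

_⊕_ : Poly → Poly → Poly
(P ⊕ Q) k = P k + Q k
infixl 6 _⊕_

X* : Poly → Poly
X* P zero    = zero
X* P (suc k) = P k

fromList : List ℕ → Poly
fromList []       k       = zero
fromList (c ∷ cs) zero    = c
fromList (c ∷ cs) (suc k) = fromList cs k

-- Annelating a 6-cycle over the edge uv: new vertices p,q,r,s are
-- N, N+1, N+2, N+3 (the Fin 4 part of Fin (N + 4)), new edges up,pq,qr,rs,sv.
annelate6 : (G : Graph) → Fin (N G) → Fin (N G) → Graph
annelate6 G u v = record { N = N G + 4 ; adj = a' }
  where
  a' : Fin (N G + 4) → Fin (N G + 4) → Bool
  a' x y with splitAt (N G) x | splitAt (N G) y
  ... | inj₁ a | inj₁ b = adj G a b
  ... | inj₁ a | inj₂ i = ((a =ᶠ u) ∧ (toℕ i ≡ᵇ 0)) ∨ ((a =ᶠ v) ∧ (toℕ i ≡ᵇ 3))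
  ... | inj₂ i | inj₁ a = ((a =ᶠ u) ∧ (toℕ i ≡ᵇ 0)) ∨ ((a =ᶠ v) ∧ (toℕ i ≡ᵇ 3))
  ... | inj₂ i | inj₂ j = (suc (toℕ i) ≡ᵇ toℕ j) ∨ (suc (toℕ j) ≡ᵇ toℕ i)

-- Edge distances are distances in the line graph, and for distinct edges e, f one has
-- d(e,f) = 1 + min d(x,y) over endpoints x of e and y of f. Annelating the hexagon leaves
-- distances between old vertices unchanged (the new u–v path is longer than the edge uv),
-- and a new vertex lies at distance 1 or 2 beyond the nearer of u, v. So an old edge f is at
-- distance 1 + d(u,f), 1 + d(v,f), 2 + d(u,f), 2 + d(v,f) and 2 + d(e,f) from the new edges
-- up, vs, pq, rs and qr, while the five new edges sit on a hexagon. Since H_e counts unordered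
-- pairs, everything is counted over ordered pairs with the endpoint formula, which is symmetric
-- and differs from d only on the diagonal, and the result is halved.

module Submission where

open import Defs
open import Data.Nat using (ℕ; zero; suc; _+_; _*_; _∸_; _≤_; _<_; z≤n; s≤s; _≤?_; _≡ᵇ_; _<ᵇ_; _≤ᵇ_; _⊓_; _⊔_; ∣_-_∣)
open import Data.Nat.Properties
open import Data.Nat.Induction using (<-rec)
open import Data.Nat.Tactic.RingSolver using (solve-∀)
open import Data.Bool using (Bool; true; false; _∧_; _∨_; if_then_else_; T)
open import Data.Bool.Properties using (∨-comm; ∨-zeroʳ; T-∨; T-∧; T-≡)
open import Data.Fin using (Fin; toℕ; splitAt; join; _↑ˡ_; _↑ʳ_; punchIn) renaming (zero to fz; suc to fs)
open import Data.Fin.Patterns using (0F; 1F; 2F; 3F; 4F)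
open import Data.Fin.Properties
  using (toℕ-injective; punchInᵢ≢i; pigeonhole; toℕ≤pred[n]; splitAt-↑ˡ; splitAt-↑ʳ; join-splitAt; ↑ʳ-injective; toℕ-↑ˡ; toℕ-↑ʳ; toℕ<n)
  renaming (_≟_ to _≟ᶠ_)
open import Data.List using (List; []; _∷_; _++_; length; lookup; allFin; concatMap; tabulate)
open import Data.List.Membership.Propositional using (_∈_; lose)
open import Data.List.Membership.Propositional.Properties using (∈-allFin; ∈-lookup; ∈-concatMap⁺; ∈-concatMap⁻)
open import Data.List.Relation.Unary.Any using (here; satisfied; index)
open import Data.List.Relation.Unary.Any.Properties using (any⁺; any⁻; lookup-index)
open import Data.Product using (_×_; _,_; proj₁; proj₂; ∃-syntax; ∃₂; Σ-syntax)
open import Data.Sum using (_⊎_; inj₁; inj₂; [_,_]′)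
open import Data.Unit using (tt)
open import Data.Empty using (⊥-elim)
open import Function using (_∘_; id; Equivalence)
open import Relation.Binary using (tri<; tri≈; tri>)
open import Relation.Binary.PropositionalEquality
open import Relation.Nullary using (¬_; yes; no)
open import Algebra.Properties.CommutativeMonoid.Sum +-0-commutativeMonoid
  using (sum; sum-syntax; sum-cong-≗; ∑-distrib-+; ∑-comm; sum-remove)
import Algebra.Properties.CommutativeSemigroup as CommSemigroupProperties

module +-CS = CommSemigroupProperties +-commutativeSemigroup
module ⊓-CS = CommSemigroupProperties ⊓-commutativeSemigroup

=ᶠ⇒≡ : ∀ {n} {i j : Fin n} → T (i =ᶠ j) → i ≡ j
=ᶠ⇒≡ {i = i} {j} t = toℕ-injective (≡ᵇ⇒≡ (toℕ i) (toℕ j) t)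

≡⇒=ᶠ : ∀ {n} {i j : Fin n} → i ≡ j → T (i =ᶠ j)
≡⇒=ᶠ {i = i} refl = ≡⇒≡ᵇ (toℕ i) (toℕ i) refl

=ᶠ-refl : ∀ {n} (i : Fin n) → (i =ᶠ i) ≡ true
=ᶠ-refl i = Equivalence.to T-≡ (≡⇒=ᶠ {i = i} refl)

≢⇒=ᶠ≡false : ∀ {n} {i j : Fin n} → ¬ i ≡ j → (i =ᶠ j) ≡ false
≢⇒=ᶠ≡false {i = i} {j} i≢j with i =ᶠ j in eq
... | true  = ⊥-elim (i≢j (=ᶠ⇒≡ (subst T (sym eq) tt)))
... | false = refl

T-∨ˡ : ∀ a {b} → T a → T (a ∨ b)
T-∨ˡ a t = Equivalence.from T-∨ (inj₁ t)

T-∨ʳ : ∀ a {b} → T b → T (a ∨ b)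
T-∨ʳ a t = Equivalence.from T-∨ (inj₂ t)

shareEnd⁺ : ∀ {n} {x} (a b c d : Fin n) → x ≡ a ⊎ x ≡ b → x ≡ c ⊎ x ≡ d → T (shareEnd (a , b) (c , d))
shareEnd⁺ a b c d (inj₁ refl) (inj₁ refl) = T-∨ˡ (a =ᶠ c) (≡⇒=ᶠ {i = a} refl)
shareEnd⁺ a b c d (inj₁ refl) (inj₂ refl) = T-∨ʳ (a =ᶠ c) (T-∨ˡ (a =ᶠ d) (≡⇒=ᶠ {i = a} refl))
shareEnd⁺ a b c d (inj₂ refl) (inj₁ refl) = T-∨ʳ (a =ᶠ c) (T-∨ʳ (a =ᶠ d) (T-∨ˡ (b =ᶠ c) (≡⇒=ᶠ {i = b} refl)))
shareEnd⁺ a b c d (inj₂ refl) (inj₂ refl) = T-∨ʳ (a =ᶠ c) (T-∨ʳ (a =ᶠ d) (T-∨ʳ (b =ᶠ c) (≡⇒=ᶠ {i = b} refl)))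

shareEnd⁻ : ∀ {n} (a b c d : Fin n) → T (shareEnd (a , b) (c , d)) → ∃[ x ] (x ≡ a ⊎ x ≡ b) × (x ≡ c ⊎ x ≡ d)
shareEnd⁻ a b c d t with Equivalence.to T-∨ t
... | inj₁ a=c = a , inj₁ refl , inj₁ (=ᶠ⇒≡ a=c)
... | inj₂ t′ with Equivalence.to T-∨ t′
... | inj₁ a=d = a , inj₁ refl , inj₂ (=ᶠ⇒≡ a=d)
... | inj₂ t″ with Equivalence.to T-∨ t″
... | inj₁ b=c = b , inj₂ refl , inj₁ (=ᶠ⇒≡ b=c)
... | inj₂ b=d = b , inj₂ refl , inj₂ (=ᶠ⇒≡ b=d)

∈-if⁻ : ∀ {A : Set} {c} {x y : A} → x ∈ (if c then y ∷ [] else []) → T c × x ≡ y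
∈-if⁻ {c = true} (here x≡y) = tt , x≡y

∈-if⁺ : ∀ {A : Set} {c} {x : A} → T c → x ∈ (if c then x ∷ [] else [])
∈-if⁺ {c = true} _ = here refl

-- Finite sums

when : Bool → ℕ → ℕ
when b n = if b then n else 0

δ : ℕ → ℕ → ℕ
δ m n = when (m ≡ᵇ n) 1

∑-zero : ∀ n {f : Fin n → ℕ} → (∀ i → f i ≡ 0) → ∑[ i < n ] f i ≡ 0
∑-zero zero    f≡0 = refl
∑-zero (suc n) f≡0 = cong₂ _+_ (f≡0 fz) (∑-zero n (f≡0 ∘ fs))

∑-const : ∀ n c → ∑[ i < n ] c ≡ n * c
∑-const zero    c = refl
∑-const (suc n) c = cong (c +_) (∑-const n c)

∑-splitAt : ∀ m n (f : Fin (m + n) → ℕ) →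
            sum f ≡ ∑[ i < m ] f (i ↑ˡ n) + ∑[ j < n ] f (m ↑ʳ j)
∑-splitAt zero    n f = refl
∑-splitAt (suc m) n f =
  trans (cong (f fz +_) (∑-splitAt m n (f ∘ fs))) (sym (+-assoc (f fz) _ _))

∑-when-=ᶠ : ∀ n (a : Fin n) (g : Fin n → ℕ) → ∑[ i < n ] when (i =ᶠ a) (g i) ≡ g a
∑-when-=ᶠ (suc n) fz     g = trans (cong (g fz +_) (∑-zero n (λ _ → refl))) (+-identityʳ _)
∑-when-=ᶠ (suc n) (fs a) g = ∑-when-=ᶠ n a (g ∘ fs)

∑-agreeExcept : ∀ {n} (a : Fin n) (g h : Fin n → ℕ) → (∀ i → ¬ i ≡ a → g i ≡ h i) →
                sum g + h a ≡ sum h + g a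
∑-agreeExcept {suc n} a g h g≗h = begin
  sum g + h a                          ≡⟨ cong (_+ h a) (sum-remove {i = a} g) ⟩
  g a + sum (g ∘ punchIn a) + h a      ≡⟨ cong (λ s → g a + s + h a) (sum-cong-≗ rest) ⟩
  g a + sum (h ∘ punchIn a) + h a      ≡⟨ +-CS.xy∙z≈zy∙x (g a) _ (h a) ⟩
  h a + sum (h ∘ punchIn a) + g a      ≡⟨ cong (_+ g a) (sum-remove {i = a} h) ⟨
  sum h + g a                          ∎
  where
  open ≡-Reasoning
  rest : ∀ j → g (punchIn a j) ≡ h (punchIn a j)
  rest j = g≗h (punchIn a j) (punchInᵢ≢i a j)

<ᵇ-suc : ∀ m n → (m <ᵇ suc n) ≡ (m ≤ᵇ n)
<ᵇ-suc zero    n = refl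
<ᵇ-suc (suc m) n = refl

when-≤ᵇ-both : ∀ a b x → when (a ≤ᵇ b) x + when (b ≤ᵇ a) x ≡ x + when (b ≡ᵇ a) x
when-≤ᵇ-both zero    zero    x = refl
when-≤ᵇ-both zero    (suc b) x = refl
when-≤ᵇ-both (suc a) zero    x = sym (+-identityʳ x)
when-≤ᵇ-both (suc a) (suc b) x
  rewrite <ᵇ-suc a b | <ᵇ-suc b a = when-≤ᵇ-both a b x

∑∑-≤ᵇ-symmetric : ∀ m (P : Fin m → Fin m → ℕ) → (∀ e f → P e f ≡ P f e) →
  2 * ∑[ e < m ] ∑[ f < m ] when (toℕ e ≤ᵇ toℕ f) (P e f)
    ≡ ∑[ e < m ] ∑[ f < m ] P e f + ∑[ e < m ] P e e
∑∑-≤ᵇ-symmetric m P P-sym = begin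
  2 * A                                      ≡⟨ cong (A +_) (+-identityʳ A) ⟩
  A + A                                      ≡⟨ cong (A +_) transposed ⟩
  A + B                                      ≡⟨ ∑-distrib-+ (λ e → ∑[ f < m ] P≤ e f) (λ e → ∑[ f < m ] P≥ e f) ⟨
  ∑[ e < m ] (∑[ f < m ] P≤ e f + ∑[ f < m ] P≥ e f)
                                             ≡⟨ sum-cong-≗ (λ e → ∑-distrib-+ (P≤ e) (P≥ e)) ⟨
  ∑[ e < m ] ∑[ f < m ] (P≤ e f + P≥ e f)    ≡⟨ sum-cong-≗ (λ e → sum-cong-≗ (λ f → when-≤ᵇ-both (toℕ e) (toℕ f) (P e f))) ⟩
  ∑[ e < m ] ∑[ f < m ] (P e f + P= e f)     ≡⟨ sum-cong-≗ (λ e → ∑-distrib-+ (P e) (P= e)) ⟩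
  ∑[ e < m ] (∑[ f < m ] P e f + ∑[ f < m ] P= e f)
                                             ≡⟨ ∑-distrib-+ (λ e → ∑[ f < m ] P e f) (λ e → ∑[ f < m ] P= e f) ⟩
  ∑[ e < m ] ∑[ f < m ] P e f + ∑[ e < m ] ∑[ f < m ] P= e f
                                             ≡⟨ cong (∑[ e < m ] ∑[ f < m ] P e f +_) (sum-cong-≗ (λ e → ∑-when-=ᶠ m e (P e))) ⟩
  ∑[ e < m ] ∑[ f < m ] P e f + ∑[ e < m ] P e e ∎
  where
  open ≡-Reasoning
  P≤ P≥ P= : Fin m → Fin m → ℕ
  P≤ e f = when (toℕ e ≤ᵇ toℕ f) (P e f)
  P≥ e f = when (toℕ f ≤ᵇ toℕ e) (P e f)
  P= e f = when (f =ᶠ e) (P e f)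
  A B : ℕ
  A = ∑[ e < m ] ∑[ f < m ] P≤ e f
  B = ∑[ e < m ] ∑[ f < m ] P≥ e f
  transposed : A ≡ B
  transposed = trans (∑-comm P≤) (sum-cong-≗ (λ e → sum-cong-≗ (λ f → cong (when (toℕ f ≤ᵇ toℕ e)) (P-sym f e))))

∑ᴸ : ∀ {A : Set} → List A → (A → ℕ) → ℕ
∑ᴸ []       f = 0
∑ᴸ (x ∷ xs) f = f x + ∑ᴸ xs f

∑ᴸ-++ : ∀ {A : Set} (xs ys : List A) f → ∑ᴸ (xs ++ ys) f ≡ ∑ᴸ xs f + ∑ᴸ ys f
∑ᴸ-++ []       ys f = refl
∑ᴸ-++ (x ∷ xs) ys f = trans (cong (f x +_) (∑ᴸ-++ xs ys f)) (sym (+-assoc (f x) _ _))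

∑ᴸ-concatMap : ∀ {A B : Set} (g : A → List B) xs f →
               ∑ᴸ (concatMap g xs) f ≡ ∑ᴸ xs (λ x → ∑ᴸ (g x) f)
∑ᴸ-concatMap g []       f = refl
∑ᴸ-concatMap g (x ∷ xs) f =
  trans (∑ᴸ-++ (g x) (concatMap g xs) f) (cong (∑ᴸ (g x) f +_) (∑ᴸ-concatMap g xs f))

∑ᴸ-tabulate : ∀ {A : Set} n (g : Fin n → A) f → ∑ᴸ (tabulate g) f ≡ ∑[ i < n ] f (g i)
∑ᴸ-tabulate zero    g f = refl
∑ᴸ-tabulate (suc n) g f = cong (f (g fz) +_) (∑ᴸ-tabulate n (g ∘ fs) f)

∑ᴸ-lookup : ∀ {A : Set} (xs : List A) f → ∑[ i < length xs ] f (lookup xs i) ≡ ∑ᴸ xs f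
∑ᴸ-lookup []       f = refl
∑ᴸ-lookup (x ∷ xs) f = cong (f x +_) (∑ᴸ-lookup xs f)

∑ᴸ-if : ∀ {A : Set} b (x : A) f → ∑ᴸ (if b then x ∷ [] else []) f ≡ when b (f x)
∑ᴸ-if true  x f = +-identityʳ _
∑ᴸ-if false x f = refl

∑ᴸ-filteredPairs : ∀ m (c : Fin m → Fin m → Bool) (F : Fin m × Fin m → ℕ) →
  ∑ᴸ (concatMap (λ i → concatMap (λ j → if c i j then (i , j) ∷ [] else []) (allFin m)) (allFin m)) F
    ≡ ∑[ i < m ] ∑[ j < m ] when (c i j) (F (i , j))
∑ᴸ-filteredPairs m c F = begin
  ∑ᴸ (concatMap row (allFin m)) F                   ≡⟨ ∑ᴸ-concatMap row (allFin m) F ⟩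
  ∑ᴸ (allFin m) (λ i → ∑ᴸ (row i) F)                ≡⟨ ∑ᴸ-tabulate m id (λ i → ∑ᴸ (row i) F) ⟩
  ∑[ i < m ] ∑ᴸ (row i) F                           ≡⟨ sum-cong-≗ (λ i → ∑ᴸ-concatMap (entry i) (allFin m) F) ⟩
  ∑[ i < m ] ∑ᴸ (allFin m) (λ j → ∑ᴸ (entry i j) F) ≡⟨ sum-cong-≗ (λ i → ∑ᴸ-tabulate m id (λ j → ∑ᴸ (entry i j) F)) ⟩
  ∑[ i < m ] ∑[ j < m ] ∑ᴸ (entry i j) F            ≡⟨ sum-cong-≗ (λ i → sum-cong-≗ (λ j → ∑ᴸ-if (c i j) (i , j) F)) ⟩
  ∑[ i < m ] ∑[ j < m ] when (c i j) (F (i , j))    ∎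
  where
  open ≡-Reasoning
  entry : Fin m → Fin m → List (Fin m × Fin m)
  entry i j = if c i j then (i , j) ∷ [] else []
  row : Fin m → List (Fin m × Fin m)
  row i = concatMap (entry i) (allFin m)

count≡∑ᴸ : ∀ {A : Set} (p : A → Bool) xs → count p xs ≡ ∑ᴸ xs (λ x → when (p x) 1)
count≡∑ᴸ p []       = refl
count≡∑ᴸ p (x ∷ xs) with p x
... | true  = cong suc (count≡∑ᴸ p xs)
... | false = count≡∑ᴸ p xs

X*-cong : ∀ {P Q : Poly} → (∀ k → P k ≡ Q k) → ∀ k → X* P k ≡ X* Q k
X*-cong P≗Q zero    = refl
X*-cong P≗Q (suc k) = P≗Q k

∑δ-suc : ∀ m (g : Fin m → ℕ) k → ∑[ f < m ] δ (suc (g f)) k ≡ X* (λ k′ → ∑[ f < m ] δ (g f) k′) k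
∑δ-suc m g zero    = ∑-zero m (λ _ → refl)
∑δ-suc m g (suc k) = refl

-- Walks and distances

search-least : ∀ (p : ℕ → Bool) B k → k ≤ B → T (p k) → T (p (search p B)) × search p B ≤ k
search-least p zero    .zero z≤n pk = pk , z≤n
search-least p (suc B) k k≤B pk with p 0 in p0
... | true = subst T (sym p0) tt , z≤n
search-least p (suc B) zero    k≤B       pk | false = ⊥-elim (subst T p0 pk)
search-least p (suc B) (suc k) (s≤s k≤B) pk | false =
  let (found , least) = search-least (p ∘ suc) B k k≤B pk in found , s≤s least

search-immediate : ∀ (p : ℕ → Bool) B → T (p 0) → search p B ≡ 0
search-immediate p zero    p0 = refl
search-immediate p (suc B) p0 with p 0
... | true = refl

module Walks (H : Graph) where

  V : Set
  V = Fin (N H)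

  infix 4 _~_
  _~_ : V → V → Set
  a ~ b = T (adj H a b)

  infixr 5 _◅_ _◅◅_
  data Walk : ℕ → V → V → Set where
    ε   : ∀ {a} → Walk 0 a a
    _◅_ : ∀ {m a b c} → a ~ b → Walk m b c → Walk (suc m) a c

  _◅◅_ : ∀ {m m' a b c} → Walk m a b → Walk m' b c → Walk (m + m') a c
  ε       ◅◅ w' = w'
  (s ◅ w) ◅◅ w' = s ◅ (w ◅◅ w')

  infixl 5 _▻_
  _▻_ : ∀ {m a b c} → Walk m a b → b ~ c → Walk (suc m) a c
  _▻_ {m} {a} {c = c} w s = subst (λ k → Walk k a c) (+-comm m 1) (w ◅◅ s ◅ ε)

  unsnoc : ∀ {m a b} → Walk (suc m) a b → ∃[ y ] Walk m a y × y ~ b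
  unsnoc (s ◅ ε)        = _ , ε , s
  unsnoc (s ◅ s' ◅ w) = let (y , w' , s'') = unsnoc (s' ◅ w) in y , s ◅ w' , s''

  reach⇒walk : ∀ k a b → T (reach H k a b) → ∃[ m ] m ≤ k × Walk m a b
  reach⇒walk zero    a b r = 0 , z≤n , subst (Walk 0 a) (=ᶠ⇒≡ r) ε
  reach⇒walk (suc k) a b r with Equivalence.to T-∨ r
  ... | inj₁ r′ = let (m , m≤k , w) = reach⇒walk k a b r′ in m , m≤n⇒m≤1+n m≤k , w
  ... | inj₂ r′ with satisfied (any⁻ _ (allFin (N H)) r′)
  ... | c , ac∧r with Equivalence.to T-∧ ac∧r
  ... | a~c , r″ = let (m , m≤k , w) = reach⇒walk k c b r″ in suc m , s≤s m≤k , a~c ◅ w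

  reach-refl : ∀ k a → T (reach H k a a)
  reach-refl zero    a = ≡⇒=ᶠ {i = a} refl
  reach-refl (suc k) a = Equivalence.from T-∨ (inj₁ (reach-refl k a))

  walk⇒reach : ∀ {k m a b} → m ≤ k → Walk m a b → T (reach H k a b)
  walk⇒reach {k} {a = a} _ ε = reach-refl k a
  walk⇒reach {suc k} {a = a} {b} (s≤s m≤k) (_◅_ {b = c} a~c w) =
    Equivalence.from T-∨ (inj₂ (any⁺ _ (lose (∈-allFin c) (Equivalence.from T-∧ (a~c , walk⇒reach m≤k w)))))

  vertexAt : ∀ {m a b} → Walk m a b → Fin (suc m) → V
  vertexAt {a = a} w       fz     = a
  vertexAt         (s ◅ w) (fs i) = vertexAt w i

  takeʷ : ∀ {m a b} (w : Walk m a b) (i : Fin (suc m)) → Walk (toℕ i) a (vertexAt w i)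
  takeʷ w       fz     = ε
  takeʷ (s ◅ w) (fs i) = s ◅ takeʷ w i

  dropʷ : ∀ {m a b} (w : Walk m a b) (i : Fin (suc m)) → Walk (m ∸ toℕ i) (vertexAt w i) b
  dropʷ w       fz     = w
  dropʷ (s ◅ w) (fs i) = dropʷ w i

  -- Pigeonhole: a walk through more than N H vertices repeats one; cut out the closed subwalk.
  shortcut : ∀ {m a b} → N H < suc m → Walk m a b → ∃[ m' ] m' < m × Walk m' a b
  shortcut {m} N<1+m w with pigeonhole N<1+m (vertexAt w)
  ... | i , j , i<j , wᵢ≡wⱼ =
    toℕ i + (m ∸ toℕ j) , shorter ,
    takeʷ w i ◅◅ subst (λ x → Walk (m ∸ toℕ j) x _) (sym wᵢ≡wⱼ) (dropʷ w j)
    where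
    shorter : toℕ i + (m ∸ toℕ j) < m
    shorter = begin-strict
      toℕ i + (m ∸ toℕ j) <⟨ +-monoˡ-< (m ∸ toℕ j) i<j ⟩
      toℕ j + (m ∸ toℕ j) ≡⟨ m+[n∸m]≡n (toℕ≤pred[n] j) ⟩
      m                   ∎
      where open ≤-Reasoning

  shorten : ∀ {m a b} → Walk m a b → ∃[ m' ] m' ≤ N H × m' ≤ m × Walk m' a b
  shorten {m} = <-rec Short step m
    where
    Short : ℕ → Set
    Short m = ∀ {a b} → Walk m a b → ∃[ m' ] m' ≤ N H × m' ≤ m × Walk m' a b
    step : ∀ m → (∀ {k} → k < m → Short k) → Short m
    step m rec w with m ≤? N H
    ... | yes m≤N = m , m≤N , ≤-refl , w
    ... | no  m≰N with shortcut (m≤n⇒m≤1+n (≰⇒> m≰N)) w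
    ... | k , k<m , w′ with rec k<m w′
    ... | m' , m'≤N , m'≤k , w″ = m' , m'≤N , ≤-trans m'≤k (<⇒≤ k<m) , w″

  private
    reached : ∀ {m a b} → Walk m a b →
              T (reach H (dist H a b) a b) × dist H a b ≤ m
    reached {m} {a} {b} w with shorten w
    ... | m' , m'≤N , m'≤m , w′ =
      let (r , d≤m') = search-least (λ k → reach H k a b) (N H) m' m'≤N (walk⇒reach ≤-refl w′)
      in r , ≤-trans d≤m' m'≤m

  dist-minimal : ∀ {m a b} → Walk m a b → dist H a b ≤ m
  dist-minimal = proj₂ ∘ reached

  geodesic : ∀ {m a b} → Walk m a b → Walk (dist H a b) a b
  geodesic {a = a} {b} w with reach⇒walk _ a b (proj₁ (reached w))
  ... | m , m≤d , w′ = subst (λ k → Walk k a b) (≤-antisym m≤d (dist-minimal w′)) w′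

  dist-refl : ∀ a → dist H a a ≡ 0
  dist-refl a = search-immediate _ (N H) (≡⇒=ᶠ {i = a} refl)

  dist≡0⇒≡ : ∀ {m a b} → Walk m a b → dist H a b ≡ 0 → a ≡ b
  dist≡0⇒≡ w d≡0 with geodesic w
  ... | w′ rewrite d≡0 with w′
  ... | ε = refl

  dist≤1⇒≡⊎~ : ∀ {m a b} → Walk m a b → dist H a b ≤ 1 → a ≡ b ⊎ a ~ b
  dist≤1⇒≡⊎~ {a = a} {b} w d≤1 with dist H a b | geodesic w
  ... | zero        | ε       = inj₁ refl
  ... | suc zero    | s ◅ ε   = inj₂ s
  ... | suc (suc _) | _ with d≤1
  ... | s≤s ()

  walk : Connected H → ∀ a b → ∃[ m ] Walk m a b
  walk conn a b = let (k , r) = conn a b ; (m , _ , w) = reach⇒walk k a b (Equivalence.from T-≡ r) in m , w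

  walks⇒connected : (∀ a b → ∃[ m ] Walk m a b) → Connected H
  walks⇒connected w a b = let (m , w′) = w a b in m , Equivalence.to T-≡ (walk⇒reach ≤-refl w′)

  module Layering (a : V) (ℓ : V → ℕ) (ℓ-root : ℓ a ≡ 0) (ℓ≡0⇒root : ∀ x → ℓ x ≡ 0 → x ≡ a)
                  (ℓ-step : ∀ {x y} → x ~ y → ℓ y ≤ suc (ℓ x))
                  (ℓ-parent : ∀ x m → ℓ x ≡ suc m → ∃[ y ] y ~ x × ℓ y ≡ m) where

    walkFromRoot : ∀ m x → ℓ x ≡ m → Walk m a x
    walkFromRoot zero    x ℓx≡0 = subst (Walk 0 a) (sym (ℓ≡0⇒root x ℓx≡0)) ε
    walkFromRoot (suc m) x ℓx≡1+m =
      let (y , y~x , ℓy≡m) = ℓ-parent x m ℓx≡1+m in walkFromRoot m y ℓy≡m ▻ y~x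

    ℓ-walk : ∀ {m x y} → Walk m x y → ℓ y ≤ ℓ x + m
    ℓ-walk {x = x} ε = m≤m+n (ℓ x) 0
    ℓ-walk {suc m} {x} (_◅_ {b = z} x~z w) = begin
      ℓ _         ≤⟨ ℓ-walk w ⟩
      ℓ z + m     ≤⟨ +-monoˡ-≤ m (ℓ-step x~z) ⟩
      suc (ℓ x) + m ≡⟨ +-suc (ℓ x) m ⟨
      ℓ x + suc m ∎
      where open ≤-Reasoning

    dist≡ℓ : ∀ x → dist H a x ≡ ℓ x
    dist≡ℓ x = ≤-antisym (dist-minimal (walkFromRoot (ℓ x) x refl))
      (≤-trans (ℓ-walk (geodesic (walkFromRoot (ℓ x) x refl))) (≤-reflexive (cong (_+ dist H a x) ℓ-root)))

  module Undirected (adj-sym : ∀ a b → adj H a b ≡ adj H b a) where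

    ~-sym : ∀ {a b} → a ~ b → b ~ a
    ~-sym {a} {b} = subst T (adj-sym a b)

    reverse : ∀ {m a b} → Walk m a b → Walk m b a
    reverse ε       = ε
    reverse (s ◅ w) = reverse w ▻ ~-sym s

    dist-sym : ∀ {m a b} → Walk m a b → dist H a b ≡ dist H b a
    dist-sym w = ≤-antisym (dist-minimal (reverse (geodesic (reverse w)))) (dist-minimal (reverse (geodesic w)))

    dist-step : ∀ {m a x y} → Walk m a x → x ~ y → dist H a y ≤ suc (dist H a x)
    dist-step w x~y = dist-minimal (geodesic w ▻ x~y)

-- Edge counts as finite sums

HeE≡∑ : ∀ H e k → HeE H e k ≡ ∑[ f < length (edges H) ] δ (edgeDist H e f) k
HeE≡∑ H e k = trans (count≡∑ᴸ (λ f → edgeDist H e f ≡ᵇ k) (allFin _)) (∑ᴸ-tabulate _ id (λ f → δ (edgeDist H e f) k))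

HeV≡∑ : ∀ H w k → HeV H w k ≡ ∑[ f < length (edges H) ] δ (vertEdgeDist H w f) k
HeV≡∑ H w k = trans (count≡∑ᴸ (λ f → vertEdgeDist H w f ≡ᵇ k) (allFin _)) (∑ᴸ-tabulate _ id (λ f → δ (vertEdgeDist H w f) k))

He≡∑∑ : ∀ H k → let m = length (edges H) in
        He H k ≡ ∑[ e < m ] ∑[ f < m ] when (toℕ e ≤ᵇ toℕ f) (δ (edgeDist H e f) k)
He≡∑∑ H k = trans (count≡∑ᴸ (λ ef → edgeDist H (proj₁ ef) (proj₂ ef) ≡ᵇ k) (edgePairs H))
                  (∑ᴸ-filteredPairs (length (edges H)) (λ e f → toℕ e ≤ᵇ toℕ f) (λ ef → δ (edgeDist H (proj₁ ef) (proj₂ ef)) k))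

∑-edges : ∀ H (F : Fin (N H) × Fin (N H) → ℕ) →
          ∑[ e < length (edges H) ] F (endpoints H e)
            ≡ ∑[ i < N H ] ∑[ j < N H ] when ((toℕ i <ᵇ toℕ j) ∧ adj H i j) (F (i , j))
∑-edges H F = trans (∑ᴸ-lookup (edges H) F) (∑ᴸ-filteredPairs (N H) (λ i j → (toℕ i <ᵇ toℕ j) ∧ adj H i j) F)

-- Line graphs of simple graphs

module SimpleGraph (H : Graph) (simple : IsSimple H) where

  open Walks H public
  open Undirected (proj₁ simple) public
  module Line = Walks (lineGraph H)

  ~-irrefl : ∀ {a b} → a ~ b → ¬ a ≡ b
  ~-irrefl {a} a~b refl = subst T (proj₂ simple a) a~b

  IsEdge : V × V → Set
  IsEdge (x , y) = T ((toℕ x <ᵇ toℕ y) ∧ adj H x y)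

  ∈-edges⁻ : ∀ {p} → p ∈ edges H → IsEdge p
  ∈-edges⁻ p∈ with satisfied (∈-concatMap⁻ _ {xs = allFin (N H)} p∈)
  ... | i , p∈ᵢ with satisfied (∈-concatMap⁻ _ {xs = allFin (N H)} p∈ᵢ)
  ... | j , p∈ᵢⱼ with ∈-if⁻ p∈ᵢⱼ
  ... | c , refl = c

  ∈-edges⁺ : ∀ {p} → IsEdge p → p ∈ edges H
  ∈-edges⁺ {x , y} c =
    ∈-concatMap⁺ _ (lose (∈-allFin x) (∈-concatMap⁺ _ (lose (∈-allFin y) (∈-if⁺ c))))

  E : Set
  E = Edge H

  ends : E → V × V
  ends = endpoints H

  ends-adjacent : ∀ e → proj₁ (ends e) ~ proj₂ (ends e)
  ends-adjacent e = proj₂ (Equivalence.to T-∧ (∈-edges⁻ (∈-lookup e)))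

  infix 4 _∈ₑ_
  _∈ₑ_ : V → E → Set
  x ∈ₑ e = x ≡ proj₁ (ends e) ⊎ x ≡ proj₂ (ends e)

  edgeOf : ∀ {x y} → x ~ y → Σ[ e ∈ E ] x ∈ₑ e × y ∈ₑ e
  edgeOf {x} {y} x~y with <-cmp (toℕ x) (toℕ y)
  ... | tri< x<y _ _ = let xy∈ = ∈-edges⁺ (Equivalence.from T-∧ (<⇒<ᵇ x<y , x~y)) ; ends≡ = lookup-index xy∈ in
    index xy∈ , inj₁ (cong proj₁ ends≡) , inj₂ (cong proj₂ ends≡)
  ... | tri≈ _ x≡y _ = ⊥-elim (~-irrefl x~y (toℕ-injective x≡y))
  ... | tri> _ _ y<x = let yx∈ = ∈-edges⁺ (Equivalence.from T-∧ (<⇒<ᵇ y<x , ~-sym x~y)) ; ends≡ = lookup-index yx∈ in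
    index yx∈ , inj₂ (cong proj₂ ends≡) , inj₁ (cong proj₁ ends≡)

  ∈ₑ-same-or-adjacent : ∀ {x y e} → x ∈ₑ e → y ∈ₑ e → x ≡ y ⊎ x ~ y
  ∈ₑ-same-or-adjacent         (inj₁ refl) (inj₁ refl) = inj₁ refl
  ∈ₑ-same-or-adjacent {e = e} (inj₁ refl) (inj₂ refl) = inj₂ (ends-adjacent e)
  ∈ₑ-same-or-adjacent {e = e} (inj₂ refl) (inj₁ refl) = inj₂ (~-sym (ends-adjacent e))
  ∈ₑ-same-or-adjacent         (inj₂ refl) (inj₂ refl) = inj₁ refl

  lineWalk⇒walk : ∀ {m e f} → Line.Walk (suc m) e f →
                  ∃₂ λ x y → x ∈ₑ e × y ∈ₑ f × ∃[ m' ] m' ≤ m × Walk m' x y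
  lineWalk⇒walk {e = e} {f} (e~f Line.◅ Line.ε) =
    let (x , x∈e , x∈f) = shareEnd⁻ _ _ _ _ (proj₂ (Equivalence.to T-∧ e~f))
    in x , x , x∈e , x∈f , 0 , z≤n , ε
  lineWalk⇒walk {e = e} (Line._◅_ {b = g} e~g w@(_ Line.◅ _)) with lineWalk⇒walk w
  ... | x , y , x∈g , y∈f , m' , m'≤m , w′ with shareEnd⁻ _ _ _ _ (proj₂ (Equivalence.to T-∧ e~g))
  ... | z , z∈e , z∈g with ∈ₑ-same-or-adjacent z∈g x∈g
  ... | inj₁ refl = z , y , z∈e , y∈f , m' , m≤n⇒m≤1+n m'≤m , w′
  ... | inj₂ z~x  = z , y , z∈e , y∈f , suc m' , s≤s m'≤m , z~x ◅ w′

  line-adjacent : ∀ {x e f} → ¬ e ≡ f → x ∈ₑ e → x ∈ₑ f → e Line.~ f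
  line-adjacent {e = e} {f} e≢f x∈e x∈f rewrite ≢⇒=ᶠ≡false e≢f = shareEnd⁺ _ _ _ _ x∈e x∈f

  walk⇒lineWalk : ∀ {m x y e f} → x ∈ₑ e → y ∈ₑ f → Walk m x y → ∃[ m' ] m' ≤ suc m × Line.Walk m' e f
  walk⇒lineWalk {e = e} {f} x∈e y∈f ε with e ≟ᶠ f
  ... | yes refl = 0 , z≤n , Line.ε
  ... | no  e≢f  = 1 , ≤-refl , line-adjacent e≢f x∈e y∈f Line.◅ Line.ε
  walk⇒lineWalk {e = e} x∈e y∈f (x~z ◅ w) with edgeOf x~z
  ... | g , x∈g , z∈g with walk⇒lineWalk z∈g y∈f w
  ... | m' , m'≤ , w′ with e ≟ᶠ g
  ... | yes refl = m' , m≤n⇒m≤1+n m'≤ , w′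
  ... | no  e≢g  = suc m' , s≤s m'≤ , line-adjacent e≢g x∈e x∈g Line.◅ w′

  -- Distance in L(H) between distinct edges, computed from the endpoints.
  lineDist : V × V → V × V → ℕ
  lineDist (x , y) (x' , y') = suc (dist H x x' ⊓ dist H x y' ⊓ dist H y x' ⊓ dist H y y')

  lineDist≡ : ∀ {x y x' y' a b c d} → dist H x x' ≡ a → dist H x y' ≡ b → dist H y x' ≡ c → dist H y y' ≡ d →
              lineDist (x , y) (x' , y') ≡ suc (a ⊓ b ⊓ c ⊓ d)
  lineDist≡ refl refl refl refl = refl

  lineDist-refl : ∀ p → lineDist p p ≡ 1
  lineDist-refl (x , y) rewrite dist-refl x = refl

  lineDist≤ : ∀ {x y e f} → x ∈ₑ e → y ∈ₑ f → lineDist (ends e) (ends f) ≤ suc (dist H x y)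
  lineDist≤ (inj₁ refl) (inj₁ refl) = s≤s (≤-trans (m⊓n≤m _ _) (≤-trans (m⊓n≤m _ _) (m⊓n≤m _ _)))
  lineDist≤ (inj₁ refl) (inj₂ refl) = s≤s (≤-trans (m⊓n≤m _ _) (≤-trans (m⊓n≤m _ _) (m⊓n≤n _ _)))
  lineDist≤ (inj₂ refl) (inj₁ refl) = s≤s (≤-trans (m⊓n≤m _ _) (m⊓n≤n _ _))
  lineDist≤ (inj₂ refl) (inj₂ refl) = s≤s (m⊓n≤n _ _)

  lineDist-attained : ∀ e f → ∃₂ λ x y → x ∈ₑ e × y ∈ₑ f × lineDist (ends e) (ends f) ≡ suc (dist H x y)
  lineDist-attained e f with ends e | ends f
  ... | x , y | x' , y' with ⊓-sel (dist H x x' ⊓ dist H x y' ⊓ dist H y x') (dist H y y')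
  ... | inj₂ eq = y , y' , inj₂ refl , inj₂ refl , cong suc eq
  ... | inj₁ eq with ⊓-sel (dist H x x' ⊓ dist H x y') (dist H y x')
  ... | inj₂ eq′ = y , x' , inj₂ refl , inj₁ refl , cong suc (trans eq eq′)
  ... | inj₁ eq′ with ⊓-sel (dist H x x') (dist H x y')
  ... | inj₂ eq″ = x , y' , inj₁ refl , inj₂ refl , cong suc (trans eq (trans eq′ eq″))
  ... | inj₁ eq″ = x , x' , inj₁ refl , inj₁ refl , cong suc (trans eq (trans eq′ eq″))

  lineDist≤lineWalk : ∀ {m e f} → ¬ e ≡ f → Line.Walk m e f → lineDist (ends e) (ends f) ≤ m
  lineDist≤lineWalk e≢f Line.ε = ⊥-elim (e≢f refl)
  lineDist≤lineWalk e≢f lw@(_ Line.◅ _) with lineWalk⇒walk lw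
  ... | x , y , x∈e , y∈f , m' , m'≤ , w = ≤-trans (lineDist≤ x∈e y∈f) (s≤s (≤-trans (dist-minimal w) m'≤))

  lineDistPairs : ℕ → ℕ
  lineDistPairs k = ∑[ e < length (edges H) ] ∑[ f < length (edges H) ] δ (lineDist (ends e) (ends f)) k

  module _ (conn : Connected H) where

    edgeDist≡lineDist : ∀ e f → ¬ e ≡ f → edgeDist H e f ≡ lineDist (ends e) (ends f)
    edgeDist≡lineDist e f e≢f with lineDist-attained e f
    ... | x , y , x∈e , y∈f , attained with walk⇒lineWalk x∈e y∈f (geodesic (proj₂ (walk conn x y)))
    ... | m' , m'≤ , lw = ≤-antisym upper lower
      where
      upper : edgeDist H e f ≤ lineDist (ends e) (ends f)
      upper = ≤-trans (Line.dist-minimal lw) (≤-trans m'≤ (≤-reflexive (sym attained)))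
      lower : lineDist (ends e) (ends f) ≤ edgeDist H e f
      lower = lineDist≤lineWalk e≢f (Line.geodesic lw)

    dist-comm : ∀ a b → dist H a b ≡ dist H b a
    dist-comm a b = dist-sym (proj₂ (walk conn a b))

    dist≡0⇒same : ∀ a b → dist H a b ≡ 0 → a ≡ b
    dist≡0⇒same a b = dist≡0⇒≡ (proj₂ (walk conn a b))

    dist-neighbour : ∀ a {x y} → x ~ y → dist H a y ≤ suc (dist H a x)
    dist-neighbour a {x} = dist-step (proj₂ (walk conn a x))

    dist-parent : ∀ a x m → dist H a x ≡ suc m → ∃[ y ] y ~ x × dist H a y ≡ m
    dist-parent a x m d≡1+m with unsnoc (subst (λ k → Walk k a x) d≡1+m (geodesic (proj₂ (walk conn a x))))
    ... | y , w , y~x = y , y~x , ≤-antisym (dist-minimal w) (≤-pred (subst (_≤ suc (dist H a y)) d≡1+m (dist-neighbour a y~x)))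

    lineDist-sym : ∀ p q → lineDist p q ≡ lineDist q p
    lineDist-sym (x , y) (x' , y') = cong suc (begin
      d x x' ⊓ d x y' ⊓ d y x' ⊓ d y y' ≡⟨ cong₂ (λ a b → a ⊓ b ⊓ d y x' ⊓ d y y') (dist-comm x x') (dist-comm x y') ⟩
      d x' x ⊓ d y' x ⊓ d y x' ⊓ d y y' ≡⟨ cong₂ (λ a b → d x' x ⊓ d y' x ⊓ a ⊓ b) (dist-comm y x') (dist-comm y y') ⟩
      d x' x ⊓ d y' x ⊓ d x' y ⊓ d y' y ≡⟨ cong (_⊓ d y' y) (⊓-CS.xy∙z≈xz∙y (d x' x) (d y' x) (d x' y)) ⟩
      d x' x ⊓ d x' y ⊓ d y' x ⊓ d y' y ∎)
      where
      open ≡-Reasoning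
      d : V → V → ℕ
      d = dist H

    edgeDist-sym : ∀ e f → edgeDist H e f ≡ edgeDist H f e
    edgeDist-sym e f with e ≟ᶠ f
    ... | yes refl = refl
    ... | no  e≢f  = trans (edgeDist≡lineDist e f e≢f)
                    (trans (lineDist-sym (ends e) (ends f)) (sym (edgeDist≡lineDist f e (e≢f ∘ sym))))

    ~⇒dist≡1 : ∀ {x y} → x ~ y → dist H x y ≡ 1
    ~⇒dist≡1 {x} {y} x~y with dist H x y in eq | dist-minimal (x~y ◅ ε)
    ... | zero     | _ = ⊥-elim (~-irrefl x~y (dist≡0⇒same x y eq))
    ... | suc zero | _ = refl
    ... | suc (suc _) | s≤s ()

    ≁⇒2≤dist : ∀ {x y} → ¬ x ~ y → ¬ x ≡ y → 2 ≤ dist H x y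
    ≁⇒2≤dist {x} {y} x≁y x≢y with dist H x y in eq
    ... | zero = ⊥-elim (x≢y (dist≡0⇒same x y eq))
    ... | suc zero with dist≤1⇒≡⊎~ (proj₂ (walk conn x y)) (≤-reflexive eq)
    ... | inj₁ x≡y = ⊥-elim (x≢y x≡y)
    ... | inj₂ x~y = ⊥-elim (x≁y x~y)
    ≁⇒2≤dist x≁y x≢y | suc (suc _) = s≤s (s≤s z≤n)

    common-neighbour⇒dist≡2 : ∀ {x z y} → x ~ z → z ~ y → ¬ x ~ y → ¬ x ≡ y → dist H x y ≡ 2
    common-neighbour⇒dist≡2 x~z z~y x≁y x≢y = ≤-antisym (dist-minimal (x~z ◅ z~y ◅ ε)) (≁⇒2≤dist x≁y x≢y)

    -- The diagonal is the only place where edgeDist (= 0) and lineDist (= 1) disagree.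
    ∑edgeDist-vs-lineDist : ∀ e k →
      ∑[ f < length (edges H) ] δ (edgeDist H e f) k + δ 1 k
        ≡ ∑[ f < length (edges H) ] δ (lineDist (ends e) (ends f)) k + δ 0 k
    ∑edgeDist-vs-lineDist e k = begin
      ∑[ f < m ] δ (edgeDist H e f) k + δ 1 k
        ≡⟨ cong (λ d → ∑[ f < m ] δ (edgeDist H e f) k + δ d k) (lineDist-refl (ends e)) ⟨
      ∑[ f < m ] δ (edgeDist H e f) k + δ (lineDist (ends e) (ends e)) k
        ≡⟨ ∑-agreeExcept e (λ f → δ (edgeDist H e f) k) (λ f → δ (lineDist (ends e) (ends f)) k)
             (λ f f≢e → cong (λ d → δ d k) (edgeDist≡lineDist e f (f≢e ∘ sym))) ⟩
      ∑[ f < m ] δ (lineDist (ends e) (ends f)) k + δ (edgeDist H e e) k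
        ≡⟨ cong (λ d → ∑[ f < m ] δ (lineDist (ends e) (ends f)) k + δ d k) (Line.dist-refl e) ⟩
      ∑[ f < m ] δ (lineDist (ends e) (ends f)) k + δ 0 k ∎
      where
      open ≡-Reasoning
      m : ℕ
      m = length (edges H)

    HeE+δ₁≡∑lineDist : ∀ e k →
      HeE H e k + δ 1 k ≡ ∑[ f < length (edges H) ] δ (lineDist (ends e) (ends f)) k + δ 0 k
    HeE+δ₁≡∑lineDist e k = trans (cong (_+ δ 1 k) (HeE≡∑ H e k)) (∑edgeDist-vs-lineDist e k)

    He-doubled : ∀ k → let m = length (edges H) in
                 2 * He H k + m * δ 1 k ≡ lineDistPairs k + 2 * (m * δ 0 k)
    He-doubled k = begin
      2 * He H k + m * δ 1 k
        ≡⟨ cong (λ h → 2 * h + m * δ 1 k) (He≡∑∑ H k) ⟩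
      2 * ∑[ e < m ] ∑[ f < m ] when (toℕ e ≤ᵇ toℕ f) (D e f) + m * δ 1 k
        ≡⟨ cong (_+ m * δ 1 k) (∑∑-≤ᵇ-symmetric m D (λ e f → cong (λ d → δ d k) (edgeDist-sym e f))) ⟩
      ∑[ e < m ] ∑[ f < m ] D e f + ∑[ e < m ] D e e + m * δ 1 k
        ≡⟨ cong (λ s → ∑[ e < m ] ∑[ f < m ] D e f + s + m * δ 1 k) diagonal ⟩
      ∑[ e < m ] ∑[ f < m ] D e f + m * δ 0 k + m * δ 1 k
        ≡⟨ +-CS.xy∙z≈xz∙y (∑[ e < m ] ∑[ f < m ] D e f) (m * δ 0 k) (m * δ 1 k) ⟩
      ∑[ e < m ] ∑[ f < m ] D e f + m * δ 1 k + m * δ 0 k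
        ≡⟨ cong (_+ m * δ 0 k) (rows (λ e → ∑[ f < m ] D e f) (δ 1 k)) ⟨
      ∑[ e < m ] (∑[ f < m ] D e f + δ 1 k) + m * δ 0 k
        ≡⟨ cong (_+ m * δ 0 k) (sum-cong-≗ (λ e → ∑edgeDist-vs-lineDist e k)) ⟩
      ∑[ e < m ] (∑[ f < m ] L e f + δ 0 k) + m * δ 0 k
        ≡⟨ cong (_+ m * δ 0 k) (rows (λ e → ∑[ f < m ] L e f) (δ 0 k)) ⟩
      lineDistPairs k + m * δ 0 k + m * δ 0 k
        ≡⟨ +-assoc (lineDistPairs k) _ _ ⟩
      lineDistPairs k + (m * δ 0 k + m * δ 0 k)
        ≡⟨ cong (lineDistPairs k +_) (cong (m * δ 0 k +_) (+-identityʳ (m * δ 0 k))) ⟨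
      lineDistPairs k + 2 * (m * δ 0 k) ∎
      where
      open ≡-Reasoning
      m : ℕ
      m = length (edges H)
      D L : Fin m → Fin m → ℕ
      D e f = δ (edgeDist H e f) k
      L e f = δ (lineDist (ends e) (ends f)) k
      diagonal : ∑[ e < m ] D e e ≡ m * δ 0 k
      diagonal = trans (sum-cong-≗ (λ e → cong (λ d → δ d k) (Line.dist-refl e))) (∑-const m (δ 0 k))
      rows : ∀ (r : Fin m → ℕ) c → ∑[ e < m ] (r e + c) ≡ ∑[ e < m ] r e + m * c
      rows r c = trans (∑-distrib-+ r (λ _ → c)) (cong (sum r +_) (∑-const m c))

-- Annelating a hexagon

module Annelation (G₀ : Graph) (simple₀ : IsSimple G₀) (conn₀ : Connected G₀) (e : Edge G₀) where

  module Old = SimpleGraph G₀ simple₀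

  n : ℕ
  n = N G₀

  u v : Fin n
  u = proj₁ (endpoints G₀ e)
  v = proj₂ (endpoints G₀ e)

  G : Graph
  G = annelate6 G₀ u v

  old : Fin n → Fin (N G)
  old a = a ↑ˡ 4

  new : Fin 4 → Fin (N G)
  new i = n ↑ʳ i

  p q r s : Fin (N G)
  p = new 0F
  q = new 1F
  r = new 2F
  s = new 3F

  data OldOrNew : Fin (N G) → Set where
    isOld : ∀ a → OldOrNew (old a)
    isNew : ∀ i → OldOrNew (new i)

  oldOrNew : ∀ x → OldOrNew x
  oldOrNew x with splitAt n x in eq
  ... | inj₁ a = subst OldOrNew (trans (cong (join n 4) (sym eq)) (join-splitAt n 4 x)) (isOld a)
  ... | inj₂ i = subst OldOrNew (trans (cong (join n 4) (sym eq)) (join-splitAt n 4 x)) (isNew i)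

  attached : Fin n → Fin 4 → Bool
  attached a i = ((a =ᶠ u) ∧ (toℕ i ≡ᵇ 0)) ∨ ((a =ᶠ v) ∧ (toℕ i ≡ᵇ 3))

  consecutive : Fin 4 → Fin 4 → Bool
  consecutive i j = (suc (toℕ i) ≡ᵇ toℕ j) ∨ (suc (toℕ j) ≡ᵇ toℕ i)

  adj-old-old : ∀ a b → adj G (old a) (old b) ≡ adj G₀ a b
  adj-old-old a b rewrite splitAt-↑ˡ n a 4 | splitAt-↑ˡ n b 4 = refl

  adj-old-new : ∀ a i → adj G (old a) (new i) ≡ attached a i
  adj-old-new a i rewrite splitAt-↑ˡ n a 4 | splitAt-↑ʳ n 4 i = refl

  adj-new-old : ∀ i a → adj G (new i) (old a) ≡ attached a i
  adj-new-old i a rewrite splitAt-↑ˡ n a 4 | splitAt-↑ʳ n 4 i = refl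

  adj-new-new : ∀ i j → adj G (new i) (new j) ≡ consecutive i j
  adj-new-new i j rewrite splitAt-↑ʳ n 4 i | splitAt-↑ʳ n 4 j = refl

  adj-sym : ∀ x y → adj G x y ≡ adj G y x
  adj-sym x y with oldOrNew x | oldOrNew y
  ... | isOld a | isOld b = trans (adj-old-old a b) (trans (proj₁ simple₀ a b) (sym (adj-old-old b a)))
  ... | isOld a | isNew j = trans (adj-old-new a j) (sym (adj-new-old j a))
  ... | isNew i | isOld b = trans (adj-new-old i b) (sym (adj-old-new b i))
  ... | isNew i | isNew j = trans (adj-new-new i j) (trans (∨-comm (suc (toℕ i) ≡ᵇ toℕ j) _) (sym (adj-new-new j i)))

  adj-irrefl : ∀ x → adj G x x ≡ false
  adj-irrefl x with oldOrNew x
  ... | isOld a = trans (adj-old-old a a) (proj₂ simple₀ a)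
  ... | isNew i = trans (adj-new-new i i) (not-consecutive i)
    where
    not-consecutive : ∀ i → consecutive i i ≡ false
    not-consecutive 0F = refl
    not-consecutive 1F = refl
    not-consecutive 2F = refl
    not-consecutive 3F = refl

  simple : IsSimple G
  simple = adj-sym , adj-irrefl

  module New = SimpleGraph G simple

  d₀ : Fin n → Fin n → ℕ
  d₀ = dist G₀

  u~v : u Old.~ v
  u~v = Old.ends-adjacent e

  -- Distances from an old vertex a in G: old distances are unchanged, and a new vertex is
  -- reached through the nearer of its attachment points u, v.
  ℓnew : Fin n → Fin 4 → ℕ
  ℓnew a 0F = 1 + d₀ a u
  ℓnew a 1F = 2 + d₀ a u
  ℓnew a 2F = 2 + d₀ a v
  ℓnew a 3F = 1 + d₀ a v

  ℓ : Fin n → Fin (N G) → ℕ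
  ℓ a x = [ d₀ a , ℓnew a ]′ (splitAt n x)

  ℓ-old : ∀ a b → ℓ a (old b) ≡ d₀ a b
  ℓ-old a b rewrite splitAt-↑ˡ n b 4 = refl

  ℓ-new : ∀ a i → ℓ a (new i) ≡ ℓnew a i
  ℓ-new a i rewrite splitAt-↑ʳ n 4 i = refl

  attached⁻ : ∀ a i → T (attached a i) → (a ≡ u × i ≡ 0F) ⊎ (a ≡ v × i ≡ 3F)
  attached⁻ a i t with Equivalence.to T-∨ t
  ... | inj₁ t′ = let (a≡u , i≡0) = Equivalence.to T-∧ t′ in inj₁ (=ᶠ⇒≡ a≡u , toℕ-injective (≡ᵇ⇒≡ (toℕ i) 0 i≡0))
  ... | inj₂ t′ = let (a≡v , i≡3) = Equivalence.to T-∧ t′ in inj₂ (=ᶠ⇒≡ a≡v , toℕ-injective (≡ᵇ⇒≡ (toℕ i) 3 i≡3))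

  ℓnew-step : ∀ a i j → T (consecutive i j) → ℓnew a j ≤ suc (ℓnew a i)
  ℓnew-step a 0F 1F _ = ≤-refl
  ℓnew-step a 1F 0F _ = s≤s (m≤n+m _ 2)
  ℓnew-step a 1F 2F _ = s≤s (s≤s (Old.dist-neighbour conn₀ a u~v))
  ℓnew-step a 2F 1F _ = s≤s (s≤s (Old.dist-neighbour conn₀ a (Old.~-sym u~v)))
  ℓnew-step a 2F 3F _ = s≤s (m≤n+m _ 2)
  ℓnew-step a 3F 2F _ = ≤-refl
  ℓnew-step a 3F 3F ()

  ~-old-new⁻ : ∀ {a i} → old a New.~ new i → (a ≡ u × i ≡ 0F) ⊎ (a ≡ v × i ≡ 3F)
  ~-old-new⁻ {a} {i} s = attached⁻ a i (subst T (adj-old-new a i) s)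

  ℓ-step : ∀ a {x y} → x New.~ y → ℓ a y ≤ suc (ℓ a x)
  ℓ-step a {x} {y} x~y with oldOrNew x | oldOrNew y
  ... | isOld b | isOld c rewrite ℓ-old a b | ℓ-old a c = Old.dist-neighbour conn₀ a (subst T (adj-old-old b c) x~y)
  ... | isOld b | isNew j rewrite ℓ-old a b | ℓ-new a j with ~-old-new⁻ x~y
  ...   | inj₁ (refl , refl) = ≤-refl
  ...   | inj₂ (refl , refl) = ≤-refl
  ℓ-step a x~y | isNew i | isOld c rewrite ℓ-new a i | ℓ-old a c with ~-old-new⁻ (New.~-sym x~y)
  ...   | inj₁ (refl , refl) = m≤n+m _ 2
  ...   | inj₂ (refl , refl) = m≤n+m _ 2
  ℓ-step a x~y | isNew i | isNew j rewrite ℓ-new a i | ℓ-new a j = ℓnew-step a i j (subst T (adj-new-new i j) x~y)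

  u~p : old u New.~ p
  u~p rewrite adj-old-new u 0F | =ᶠ-refl u = tt

  v~s : old v New.~ s
  v~s rewrite adj-old-new v 3F | =ᶠ-refl v | ∨-zeroʳ ((v =ᶠ u) ∧ false) = tt

  new~new : ∀ i j → T (consecutive i j) → new i New.~ new j
  new~new i j = subst T (sym (adj-new-new i j))

  ℓ-parent : ∀ a x m → ℓ a x ≡ suc m → ∃[ y ] y New.~ x × ℓ a y ≡ m
  ℓ-parent a x m ℓ≡1+m with oldOrNew x
  ... | isOld b = let (y , y~b , d≡m) = Old.dist-parent conn₀ a b m (trans (sym (ℓ-old a b)) ℓ≡1+m)
                  in old y , subst T (sym (adj-old-old y b)) y~b , trans (ℓ-old a y) d≡m
  ... | isNew i = newParent i (trans (sym (ℓ-new a i)) ℓ≡1+m)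
    where
    newParent : ∀ i → ℓnew a i ≡ suc m → ∃[ y ] y New.~ new i × ℓ a y ≡ m
    newParent 0F ℓ≡ = old u , u~p , trans (ℓ-old a u) (suc-injective ℓ≡)
    newParent 1F ℓ≡ = p , new~new 0F 1F tt , trans (ℓ-new a 0F) (suc-injective ℓ≡)
    newParent 2F ℓ≡ = s , new~new 3F 2F tt , trans (ℓ-new a 3F) (suc-injective ℓ≡)
    newParent 3F ℓ≡ = old v , v~s , trans (ℓ-old a v) (suc-injective ℓ≡)

  ℓ≡0⇒root : ∀ a x → ℓ a x ≡ 0 → x ≡ old a
  ℓ≡0⇒root a x ℓ≡0 with oldOrNew x
  ... | isOld b = cong old (sym (Old.dist≡0⇒same conn₀ a b (trans (sym (ℓ-old a b)) ℓ≡0)))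
  ... | isNew i = ⊥-elim (ℓnew≢0 i (trans (sym (ℓ-new a i)) ℓ≡0))
    where
    ℓnew≢0 : ∀ i → ¬ ℓnew a i ≡ 0
    ℓnew≢0 0F ()
    ℓnew≢0 1F ()
    ℓnew≢0 2F ()
    ℓnew≢0 3F ()

  module FromOld (a : Fin n) = New.Layering (old a) (ℓ a) (trans (ℓ-old a a) (Old.dist-refl a))
                                 (ℓ≡0⇒root a) (ℓ-step a) (ℓ-parent a)

  dist-old : ∀ a x → dist G (old a) x ≡ ℓ a x
  dist-old a = FromOld.dist≡ℓ a

  connected : Connected G
  connected = New.walks⇒connected walkBetween
    where
    walkFrom-u : ∀ x → ∃[ m ] New.Walk m (old u) x
    walkFrom-u x = _ , FromOld.walkFromRoot u (ℓ u x) x refl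
    walkBetween : ∀ x y → ∃[ m ] New.Walk m x y
    walkBetween x y = let (_ , w) = walkFrom-u x ; (_ , w′) = walkFrom-u y in _ , New.reverse w New.◅◅ w′

  oldPair : Fin n × Fin n → Fin (N G) × Fin (N G)
  oldPair (a , b) = old a , old b

  newEdge : Fin 5 → Fin (N G) × Fin (N G)
  newEdge 0F = old u , p
  newEdge 1F = old v , s
  newEdge 2F = p , q
  newEdge 3F = q , r
  newEdge 4F = r , s

  m₀ : ℕ
  m₀ = length (edges G₀)

  private
    edgeTerm : (Fin (N G) × Fin (N G) → ℕ) → Fin (N G) → Fin (N G) → ℕ
    edgeTerm F x y = when ((toℕ x <ᵇ toℕ y) ∧ adj G x y) (F (x , y))

    +<ᵇ+ : ∀ m a b → (m + a <ᵇ m + b) ≡ (a <ᵇ b)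
    +<ᵇ+ zero    a b = refl
    +<ᵇ+ (suc m) a b = +<ᵇ+ m a b

    edgeTerm-old-old : ∀ F a b → edgeTerm F (old a) (old b) ≡ when ((toℕ a <ᵇ toℕ b) ∧ adj G₀ a b) (F (oldPair (a , b)))
    edgeTerm-old-old F a b rewrite toℕ-↑ˡ a 4 | toℕ-↑ˡ b 4 | adj-old-old a b = refl

    edgeTerm-old-new : ∀ F a i → edgeTerm F (old a) (new i) ≡ when (attached a i) (F (old a , new i))
    edgeTerm-old-new F a i rewrite toℕ-↑ˡ a 4 | toℕ-↑ʳ n i | adj-old-new a i
      with toℕ a <ᵇ n + toℕ i in lt
    ... | true  = refl
    ... | false = ⊥-elim (subst T lt (<⇒<ᵇ (≤-trans (toℕ<n a) (m≤m+n n (toℕ i)))))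

    edgeTerm-new-old : ∀ F i a → edgeTerm F (new i) (old a) ≡ 0
    edgeTerm-new-old F i a rewrite toℕ-↑ˡ a 4 | toℕ-↑ʳ n i with n + toℕ i <ᵇ toℕ a in lt
    ... | true  = ⊥-elim (<⇒≱ (<ᵇ⇒< _ _ (subst T (sym lt) tt)) (≤-trans (<⇒≤ (toℕ<n a)) (m≤m+n n (toℕ i))))
    ... | false = refl

    edgeTerm-new-new : ∀ F i j → edgeTerm F (new i) (new j) ≡ when ((toℕ i <ᵇ toℕ j) ∧ consecutive i j) (F (new i , new j))
    edgeTerm-new-new F i j rewrite toℕ-↑ʳ n i | toℕ-↑ʳ n j | +<ᵇ+ n (toℕ i) (toℕ j) | adj-new-new i j = refl

    attachedRow : ∀ a (g : Fin 4 → ℕ) → ∑[ i < 4 ] when (attached a i) (g i) ≡ when (a =ᶠ u) (g 0F) + when (a =ᶠ v) (g 3F)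
    attachedRow a g with a =ᶠ u | a =ᶠ v
    ... | true  | true  = cong (g 0F +_) (+-identityʳ _)
    ... | true  | false = refl
    ... | false | true  = +-identityʳ _
    ... | false | false = refl

    ∑∑-edgeTerm-old-old : ∀ F → ∑[ a < n ] ∑[ b < n ] edgeTerm F (old a) (old b) ≡ ∑[ f < m₀ ] F (oldPair (endpoints G₀ f))
    ∑∑-edgeTerm-old-old F = trans (sum-cong-≗ (λ a → sum-cong-≗ (edgeTerm-old-old F a))) (sym (∑-edges G₀ (F ∘ oldPair)))

    ∑∑-edgeTerm-old-new : ∀ F → ∑[ a < n ] ∑[ j < 4 ] edgeTerm F (old a) (new j) ≡ F (newEdge 0F) + F (newEdge 1F)
    ∑∑-edgeTerm-old-new F = begin
      ∑[ a < n ] ∑[ j < 4 ] edgeTerm F (old a) (new j)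
        ≡⟨ sum-cong-≗ (λ a → trans (sum-cong-≗ (edgeTerm-old-new F a)) (attachedRow a (λ j → F (old a , new j)))) ⟩
      ∑[ a < n ] (when (a =ᶠ u) (F (old a , p)) + when (a =ᶠ v) (F (old a , s)))
        ≡⟨ ∑-distrib-+ (λ a → when (a =ᶠ u) (F (old a , p))) (λ a → when (a =ᶠ v) (F (old a , s))) ⟩
      ∑[ a < n ] when (a =ᶠ u) (F (old a , p)) + ∑[ a < n ] when (a =ᶠ v) (F (old a , s))
        ≡⟨ cong₂ _+_ (∑-when-=ᶠ n u (λ a → F (old a , p))) (∑-when-=ᶠ n v (λ a → F (old a , s))) ⟩
      F (newEdge 0F) + F (newEdge 1F) ∎
      where open ≡-Reasoning

    ∑∑-edgeTerm-new-new : ∀ F → ∑[ i < 4 ] ∑[ j < 4 ] edgeTerm F (new i) (new j) ≡ F (newEdge 2F) + F (newEdge 3F) + F (newEdge 4F)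
    ∑∑-edgeTerm-new-new F = trans (sum-cong-≗ (λ i → sum-cong-≗ (edgeTerm-new-new F i)))
                                  (path-edges (F (newEdge 2F)) (F (newEdge 3F)) (F (newEdge 4F)))
      where
      path-edges : ∀ a b c → a + 0 + (b + 0 + (c + 0 + 0)) ≡ a + b + c
      path-edges = solve-∀

  ∑-edges-annelate : ∀ (F : Fin (N G) × Fin (N G) → ℕ) → ∑[ f < length (edges G) ] F (endpoints G f)
                     ≡ ∑[ f < m₀ ] F (oldPair (endpoints G₀ f)) + ∑[ i < 5 ] F (newEdge i)
  ∑-edges-annelate F = begin
    ∑[ f < length (edges G) ] F (endpoints G f)
      ≡⟨ ∑-edges G F ⟩
    ∑[ x < n + 4 ] ∑[ y < n + 4 ] edgeTerm F x y
      ≡⟨ sum-cong-≗ (λ x → ∑-splitAt n 4 (edgeTerm F x)) ⟩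
    ∑[ x < n + 4 ] (∑[ b < n ] edgeTerm F x (old b) + ∑[ j < 4 ] edgeTerm F x (new j))
      ≡⟨ ∑-splitAt n 4 (λ x → ∑[ b < n ] edgeTerm F x (old b) + ∑[ j < 4 ] edgeTerm F x (new j)) ⟩
    ∑[ a < n ] (∑[ b < n ] edgeTerm F (old a) (old b) + ∑[ j < 4 ] edgeTerm F (old a) (new j))
      + ∑[ i < 4 ] (∑[ b < n ] edgeTerm F (new i) (old b) + ∑[ j < 4 ] edgeTerm F (new i) (new j))
      ≡⟨ cong₂ _+_ (∑-distrib-+ (λ a → ∑[ b < n ] edgeTerm F (old a) (old b)) (λ a → ∑[ j < 4 ] edgeTerm F (old a) (new j)))
                   (sum-cong-≗ (λ i → cong (_+ ∑[ j < 4 ] edgeTerm F (new i) (new j)) (∑-zero n (edgeTerm-new-old F i)))) ⟩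
    (∑[ a < n ] ∑[ b < n ] edgeTerm F (old a) (old b) + ∑[ a < n ] ∑[ j < 4 ] edgeTerm F (old a) (new j))
      + ∑[ i < 4 ] ∑[ j < 4 ] edgeTerm F (new i) (new j)
      ≡⟨ cong₂ _+_ (cong₂ _+_ (∑∑-edgeTerm-old-old F) (∑∑-edgeTerm-old-new F)) (∑∑-edgeTerm-new-new F) ⟩
    (∑[ f < m₀ ] F (oldPair (endpoints G₀ f)) + (F (newEdge 0F) + F (newEdge 1F)))
      + (F (newEdge 2F) + F (newEdge 3F) + F (newEdge 4F))
      ≡⟨ regroup (∑[ f < m₀ ] F (oldPair (endpoints G₀ f))) (F (newEdge 0F)) (F (newEdge 1F))
                 (F (newEdge 2F)) (F (newEdge 3F)) (F (newEdge 4F)) ⟩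
    ∑[ f < m₀ ] F (oldPair (endpoints G₀ f)) + ∑[ i < 5 ] F (newEdge i) ∎
    where
    open ≡-Reasoning
    regroup : ∀ o a b c d e → (o + (a + b)) + (c + d + e) ≡ o + (a + (b + (c + (d + (e + 0)))))
    regroup = solve-∀

  ∑∑-edges-annelate : ∀ (F : Fin (N G) × Fin (N G) → Fin (N G) × Fin (N G) → ℕ) →
    ∑[ x < length (edges G) ] ∑[ y < length (edges G) ] F (endpoints G x) (endpoints G y)
    ≡ (∑[ f < m₀ ] ∑[ g < m₀ ] F (oldPair (endpoints G₀ f)) (oldPair (endpoints G₀ g))
        + ∑[ f < m₀ ] ∑[ i < 5 ] F (oldPair (endpoints G₀ f)) (newEdge i))
      + (∑[ i < 5 ] ∑[ g < m₀ ] F (newEdge i) (oldPair (endpoints G₀ g)) + ∑[ i < 5 ] ∑[ j < 5 ] F (newEdge i) (newEdge j))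
  ∑∑-edges-annelate F = trans (∑-edges-annelate (λ x → ∑[ y < length (edges G) ] F x (endpoints G y)))
    (cong₂ _+_ (trans (sum-cong-≗ (λ f → ∑-edges-annelate (F (old′ f)))) (∑-distrib-+ (λ f → ∑[ g < m₀ ] F (old′ f) (old′ g)) (λ f → ∑[ i < 5 ] F (old′ f) (newEdge i))))
               (trans (sum-cong-≗ (λ i → ∑-edges-annelate (F (newEdge i)))) (∑-distrib-+ (λ i → ∑[ g < m₀ ] F (newEdge i) (old′ g)) (λ i → ∑[ j < 5 ] F (newEdge i) (newEdge j)))))
    where
    old′ : Fin m₀ → Fin (N G) × Fin (N G)
    old′ f = oldPair (endpoints G₀ f)

  dist-comm : ∀ x y → dist G x y ≡ dist G y x
  dist-comm = New.dist-comm connected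

  dist-old-old : ∀ a b → dist G (old a) (old b) ≡ d₀ a b
  dist-old-old a b = trans (dist-old a (old b)) (ℓ-old a b)

  dist-old-new : ∀ a i → dist G (old a) (new i) ≡ ℓnew a i
  dist-old-new a i = trans (dist-old a (new i)) (ℓ-new a i)

  d₀-uv : d₀ u v ≡ 1
  d₀-uv = Old.~⇒dist≡1 conn₀ u~v

  d₀-vu : d₀ v u ≡ 1
  d₀-vu = Old.~⇒dist≡1 conn₀ (Old.~-sym u~v)

  -- Positions of the new edges along the hexagon u p q r s v (position 5 is uv): lineDist of
  -- two edges of the hexagon is their cyclic distance, and 1 on the diagonal.
  hexPosition : Fin 5 → ℕ
  hexPosition 0F = 0
  hexPosition 1F = 4
  hexPosition 2F = 1
  hexPosition 3F = 2
  hexPosition 4F = 3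

  hexDist : Fin 5 → Fin 5 → ℕ
  hexDist i j = 1 ⊔ (∣ hexPosition i - hexPosition j ∣ ⊓ (6 ∸ ∣ hexPosition i - hexPosition j ∣))

  private
    d-uv : dist G (old u) (old v) ≡ 1
    d-uv = trans (dist-old-old u v) d₀-uv
    d-up : dist G (old u) p ≡ 1
    d-up = trans (dist-old-new u 0F) (cong (1 +_) (Old.dist-refl u))
    d-uq : dist G (old u) q ≡ 2
    d-uq = trans (dist-old-new u 1F) (cong (2 +_) (Old.dist-refl u))
    d-ur : dist G (old u) r ≡ 3
    d-ur = trans (dist-old-new u 2F) (cong (2 +_) d₀-uv)
    d-us : dist G (old u) s ≡ 2
    d-us = trans (dist-old-new u 3F) (cong (1 +_) d₀-uv)
    d-vp : dist G (old v) p ≡ 2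
    d-vp = trans (dist-old-new v 0F) (cong (1 +_) d₀-vu)
    d-vq : dist G (old v) q ≡ 3
    d-vq = trans (dist-old-new v 1F) (cong (2 +_) d₀-vu)
    d-vr : dist G (old v) r ≡ 2
    d-vr = trans (dist-old-new v 2F) (cong (2 +_) (Old.dist-refl v))
    d-vs : dist G (old v) s ≡ 1
    d-vs = trans (dist-old-new v 3F) (cong (1 +_) (Old.dist-refl v))
    d-pv : dist G p (old v) ≡ 2
    d-pv = trans (dist-comm p (old v)) d-vp
    d-pq : dist G p q ≡ 1
    d-pq = New.~⇒dist≡1 connected (new~new 0F 1F tt)
    d-qr : dist G q r ≡ 1
    d-qr = New.~⇒dist≡1 connected (new~new 1F 2F tt)
    d-rs : dist G r s ≡ 1
    d-rs = New.~⇒dist≡1 connected (new~new 2F 3F tt)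
    d-sr : dist G s r ≡ 1
    d-sr = New.~⇒dist≡1 connected (new~new 3F 2F tt)
    new≢new : ∀ {i j} → ¬ i ≡ j → ¬ new i ≡ new j
    new≢new {i} {j} i≢j = i≢j ∘ ↑ʳ-injective n i j
    d-pr : dist G p r ≡ 2
    d-pr = New.common-neighbour⇒dist≡2 connected (new~new 0F 1F tt) (new~new 1F 2F tt)
             (subst T (adj-new-new 0F 2F)) (new≢new (λ ()))
    d-qs : dist G q s ≡ 2
    d-qs = New.common-neighbour⇒dist≡2 connected (new~new 1F 2F tt) (new~new 2F 3F tt)
             (subst T (adj-new-new 1F 3F)) (new≢new (λ ()))
    d-sq : dist G s q ≡ 2
    d-sq = trans (dist-comm s q) d-qs
    -- In fact d(p,s) = 3, but 2 ≤ d(p,s) suffices: it is never the minimum in a lineDist below.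
    2≤d-ps : 2 ≤ dist G p s
    2≤d-ps = New.≁⇒2≤dist connected (subst T (adj-new-new 0F 3F)) (new≢new (λ ()))
    d-ps : dist G p s ≡ 2 + (dist G p s ∸ 2)
    d-ps = sym (m+[n∸m]≡n 2≤d-ps)
    d-sp : dist G s p ≡ 2 + (dist G p s ∸ 2)
    d-sp = trans (dist-comm s p) d-ps

    swapped : ∀ i j → New.lineDist (newEdge i) (newEdge j) ≡ hexDist i j →
              New.lineDist (newEdge j) (newEdge i) ≡ hexDist i j
    swapped i j = trans (New.lineDist-sym connected (newEdge j) (newEdge i))

  lineDist-newEdges : ∀ i j → New.lineDist (newEdge i) (newEdge j) ≡ hexDist i j
  lineDist-newEdges 0F 0F = New.lineDist-refl (newEdge 0F)
  lineDist-newEdges 0F 1F = New.lineDist≡ d-uv d-us d-pv d-ps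
  lineDist-newEdges 0F 2F = New.lineDist≡ d-up d-uq (New.dist-refl p) d-pq
  lineDist-newEdges 0F 3F = New.lineDist≡ d-uq d-ur d-pq d-pr
  lineDist-newEdges 0F 4F = New.lineDist≡ d-ur d-us d-pr d-ps
  lineDist-newEdges 1F 1F = New.lineDist-refl (newEdge 1F)
  lineDist-newEdges 1F 2F = New.lineDist≡ d-vp d-vq d-sp d-sq
  lineDist-newEdges 1F 3F = New.lineDist≡ d-vq d-vr d-sq d-sr
  lineDist-newEdges 1F 4F = New.lineDist≡ d-vr d-vs d-sr (New.dist-refl s)
  lineDist-newEdges 2F 2F = New.lineDist-refl (newEdge 2F)
  lineDist-newEdges 2F 3F = New.lineDist≡ d-pq d-pr (New.dist-refl q) d-qr
  lineDist-newEdges 2F 4F = New.lineDist≡ d-pr d-ps d-qr d-qs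
  lineDist-newEdges 3F 3F = New.lineDist-refl (newEdge 3F)
  lineDist-newEdges 3F 4F = New.lineDist≡ d-qr d-qs (New.dist-refl r) d-rs
  lineDist-newEdges 4F 4F = New.lineDist-refl (newEdge 4F)
  lineDist-newEdges 1F 0F = swapped 0F 1F (lineDist-newEdges 0F 1F)
  lineDist-newEdges 2F 0F = swapped 0F 2F (lineDist-newEdges 0F 2F)
  lineDist-newEdges 3F 0F = swapped 0F 3F (lineDist-newEdges 0F 3F)
  lineDist-newEdges 4F 0F = swapped 0F 4F (lineDist-newEdges 0F 4F)
  lineDist-newEdges 2F 1F = swapped 1F 2F (lineDist-newEdges 1F 2F)
  lineDist-newEdges 3F 1F = swapped 1F 3F (lineDist-newEdges 1F 3F)
  lineDist-newEdges 4F 1F = swapped 1F 4F (lineDist-newEdges 1F 4F)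
  lineDist-newEdges 3F 2F = swapped 2F 3F (lineDist-newEdges 2F 3F)
  lineDist-newEdges 4F 2F = swapped 2F 4F (lineDist-newEdges 2F 4F)
  lineDist-newEdges 4F 3F = swapped 3F 4F (lineDist-newEdges 3F 4F)

  ∑∑-newEdges : ∀ k → ∑[ i < 5 ] ∑[ j < 5 ] δ (New.lineDist (newEdge i) (newEdge j)) k
                      ≡ 13 * δ 1 k + 8 * δ 2 k + 4 * δ 3 k
  ∑∑-newEdges k = trans (sum-cong-≗ (λ i → sum-cong-≗ (λ j → cong (λ d → δ d k) (lineDist-newEdges i j))))
                        (hexagon-count k)
    where
    hexagon-count : ∀ k → ∑[ i < 5 ] ∑[ j < 5 ] δ (hexDist i j) k ≡ 13 * δ 1 k + 8 * δ 2 k + 4 * δ 3 k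
    hexagon-count 0 = refl
    hexagon-count 1 = refl
    hexagon-count 2 = refl
    hexagon-count 3 = refl
    hexagon-count (suc (suc (suc (suc k)))) = refl

  private
    ⊓-suc-absorbs : ∀ x y → x ⊓ suc x ⊓ y ⊓ suc y ≡ x ⊓ y
    ⊓-suc-absorbs x y = trans (cong (λ z → z ⊓ y ⊓ suc y) (m≤n⇒m⊓n≡m (n≤1+n x)))
      (trans (⊓-assoc x y (suc y)) (cong (x ⊓_) (m≤n⇒m⊓n≡m (n≤1+n y))))

    suc-⊓-absorbs : ∀ x y → suc x ⊓ x ⊓ suc y ⊓ y ≡ x ⊓ y
    suc-⊓-absorbs x y = trans (cong (λ z → z ⊓ suc y ⊓ y) (m≥n⇒m⊓n≡n (n≤1+n x)))
      (trans (⊓-assoc x (suc y) y) (cong (x ⊓_) (m≥n⇒m⊓n≡n (n≤1+n y))))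

  vertPairDist₀ : Fin n → Fin n × Fin n → ℕ
  vertPairDist₀ w (a , b) = d₀ w a ⊓ d₀ w b

  d₀-comm : ∀ a b → d₀ a b ≡ d₀ b a
  d₀-comm = Old.dist-comm conn₀

  lineDist-old-up : ∀ ab → New.lineDist (oldPair ab) (newEdge 0F) ≡ 1 + vertPairDist₀ u ab
  lineDist-old-up (a , b) =
    trans (New.lineDist≡ (dist-old-old a u) (dist-old-new a 0F) (dist-old-old b u) (dist-old-new b 0F))
          (cong suc (trans (⊓-suc-absorbs (d₀ a u) (d₀ b u)) (cong₂ _⊓_ (d₀-comm a u) (d₀-comm b u))))

  lineDist-old-vs : ∀ ab → New.lineDist (oldPair ab) (newEdge 1F) ≡ 1 + vertPairDist₀ v ab
  lineDist-old-vs (a , b) =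
    trans (New.lineDist≡ (dist-old-old a v) (dist-old-new a 3F) (dist-old-old b v) (dist-old-new b 3F))
          (cong suc (trans (⊓-suc-absorbs (d₀ a v) (d₀ b v)) (cong₂ _⊓_ (d₀-comm a v) (d₀-comm b v))))

  lineDist-old-pq : ∀ ab → New.lineDist (oldPair ab) (newEdge 2F) ≡ 2 + vertPairDist₀ u ab
  lineDist-old-pq (a , b) =
    trans (New.lineDist≡ (dist-old-new a 0F) (dist-old-new a 1F) (dist-old-new b 0F) (dist-old-new b 1F))
          (cong (2 +_) (trans (⊓-suc-absorbs (d₀ a u) (d₀ b u)) (cong₂ _⊓_ (d₀-comm a u) (d₀-comm b u))))

  lineDist-old-qr : ∀ ab → New.lineDist (oldPair ab) (newEdge 3F) ≡ 2 + Old.lineDist ab (u , v)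
  lineDist-old-qr (a , b) = New.lineDist≡ (dist-old-new a 1F) (dist-old-new a 2F) (dist-old-new b 1F) (dist-old-new b 2F)

  lineDist-old-rs : ∀ ab → New.lineDist (oldPair ab) (newEdge 4F) ≡ 2 + vertPairDist₀ v ab
  lineDist-old-rs (a , b) =
    trans (New.lineDist≡ (dist-old-new a 2F) (dist-old-new a 3F) (dist-old-new b 2F) (dist-old-new b 3F))
          (cong (2 +_) (trans (suc-⊓-absorbs (d₀ a v) (d₀ b v)) (cong₂ _⊓_ (d₀-comm a v) (d₀-comm b v))))

  lineDist-old-old : ∀ ab cd → New.lineDist (oldPair ab) (oldPair cd) ≡ Old.lineDist ab cd
  lineDist-old-old (a , b) (c , d) = New.lineDist≡ (dist-old-old a c) (dist-old-old a d) (dist-old-old b c) (dist-old-old b d)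

  edgeCount : length (edges G) ≡ m₀ + 5
  edgeCount = begin
    length (edges G)                     ≡⟨ *-identityʳ _ ⟨
    length (edges G) * 1                 ≡⟨ ∑-const (length (edges G)) 1 ⟨
    ∑[ f < length (edges G) ] 1          ≡⟨ ∑-edges-annelate (λ _ → 1) ⟩
    ∑[ f < m₀ ] 1 + 5                    ≡⟨ cong (_+ 5) (trans (∑-const m₀ 1) (*-identityʳ m₀)) ⟩
    m₀ + 5                               ∎
    where open ≡-Reasoning

  oldEdgesAt : Fin 5 → ℕ → ℕ
  oldEdgesAt i k = ∑[ f < m₀ ] δ (New.lineDist (oldPair (endpoints G₀ f)) (newEdge i)) k

  oldEdgesAt-1+ : ∀ i w → (∀ ab → New.lineDist (oldPair ab) (newEdge i) ≡ 1 + vertPairDist₀ w ab) →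
                   ∀ k → oldEdgesAt i k ≡ X* (HeV G₀ w) k
  oldEdgesAt-1+ i w lineDist≡1+ k = begin
    oldEdgesAt i k                                       ≡⟨ sum-cong-≗ (λ f → cong (λ d → δ d k) (lineDist≡1+ (endpoints G₀ f))) ⟩
    ∑[ f < m₀ ] δ (suc (vertEdgeDist G₀ w f)) k        ≡⟨ ∑δ-suc m₀ (vertEdgeDist G₀ w) k ⟩
    X* (λ k → ∑[ f < m₀ ] δ (vertEdgeDist G₀ w f) k) k ≡⟨ X*-cong (λ k → sym (HeV≡∑ G₀ w k)) k ⟩
    X* (HeV G₀ w) k                                    ∎
    where open ≡-Reasoning

  oldEdgesAt-2+ : ∀ i w → (∀ ab → New.lineDist (oldPair ab) (newEdge i) ≡ 2 + vertPairDist₀ w ab) →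
                   ∀ k → oldEdgesAt i k ≡ X* (X* (HeV G₀ w)) k
  oldEdgesAt-2+ i w lineDist≡2+ k = begin
    oldEdgesAt i k                                       ≡⟨ sum-cong-≗ (λ f → cong (λ d → δ d k) (lineDist≡2+ (endpoints G₀ f))) ⟩
    ∑[ f < m₀ ] δ (2 + vertEdgeDist G₀ w f) k          ≡⟨ ∑δ-suc m₀ (suc ∘ vertEdgeDist G₀ w) k ⟩
    X* (λ k → ∑[ f < m₀ ] δ (suc (vertEdgeDist G₀ w f)) k) k
                                                       ≡⟨ X*-cong (λ k → ∑δ-suc m₀ (vertEdgeDist G₀ w) k) k ⟩
    X* (X* (λ k → ∑[ f < m₀ ] δ (vertEdgeDist G₀ w f) k)) k
                                                       ≡⟨ X*-cong (X*-cong (λ k → sym (HeV≡∑ G₀ w k))) k ⟩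
    X* (X* (HeV G₀ w)) k                               ∎
    where open ≡-Reasoning

  -- d(f, qr) = 2 + d(f, e) for every old edge f ≠ e, but d(e, qr) = 3 while d(e, e) = 0.
  oldEdgesAt-qr : ∀ k → X* (X* (HeE G₀ e)) k + δ 3 k ≡ oldEdgesAt 3F k + δ 2 k
  oldEdgesAt-qr k = trans (shifted k)
    (cong (_+ δ 2 k) (sum-cong-≗ (λ f → cong (λ d → δ d k) (sym (lineDist-old-qr (endpoints G₀ f))))))
    where
    shifted : ∀ k → X* (X* (HeE G₀ e)) k + δ 3 k
                    ≡ ∑[ f < m₀ ] δ (2 + Old.lineDist (endpoints G₀ f) (u , v)) k + δ 2 k
    shifted 0 = sym (cong (_+ 0) (∑-zero m₀ (λ _ → refl)))
    shifted 1 = sym (cong (_+ 0) (∑-zero m₀ (λ _ → refl)))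
    shifted (suc (suc k)) = trans (Old.HeE+δ₁≡∑lineDist conn₀ e k)
      (cong (_+ δ 0 k) (sum-cong-≗ (λ f → cong (λ d → δ d k) (Old.lineDist-sym conn₀ (u , v) (endpoints G₀ f)))))

  lineDistPairs-annelate : ∀ k →
    New.lineDistPairs k ≡ Old.lineDistPairs k + 2 * ∑[ i < 5 ] oldEdgesAt i k + (13 * δ 1 k + 8 * δ 2 k + 4 * δ 3 k)
  lineDistPairs-annelate k = begin
    New.lineDistPairs k
      ≡⟨ ∑∑-edges-annelate L ⟩
    (∑[ f < m₀ ] ∑[ g < m₀ ] L (old′ f) (old′ g) + ∑[ f < m₀ ] ∑[ i < 5 ] L (old′ f) (newEdge i))
      + (∑[ i < 5 ] ∑[ g < m₀ ] L (newEdge i) (old′ g) + ∑[ i < 5 ] ∑[ j < 5 ] L (newEdge i) (newEdge j))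
      ≡⟨ cong₂ _+_ (cong₂ _+_ oldBlock (∑-comm (λ f i → L (old′ f) (newEdge i))))
                   (cong₂ _+_ transposedBlock (∑∑-newEdges k)) ⟩
    (Old.lineDistPairs k + A) + (A + hexagonTerms)
      ≡⟨ regroup (Old.lineDistPairs k) A hexagonTerms ⟩
    Old.lineDistPairs k + 2 * A + hexagonTerms ∎
    where
    open ≡-Reasoning
    old′ : Fin m₀ → Fin (N G) × Fin (N G)
    old′ f = oldPair (endpoints G₀ f)
    L : Fin (N G) × Fin (N G) → Fin (N G) × Fin (N G) → ℕ
    L x y = δ (New.lineDist x y) k
    A hexagonTerms : ℕ
    A = ∑[ i < 5 ] oldEdgesAt i k
    hexagonTerms = 13 * δ 1 k + 8 * δ 2 k + 4 * δ 3 k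
    oldBlock : ∑[ f < m₀ ] ∑[ g < m₀ ] L (old′ f) (old′ g) ≡ Old.lineDistPairs k
    oldBlock = sum-cong-≗ (λ f → sum-cong-≗ (λ g → cong (λ d → δ d k) (lineDist-old-old (endpoints G₀ f) (endpoints G₀ g))))
    transposedBlock : ∑[ i < 5 ] ∑[ g < m₀ ] L (newEdge i) (old′ g) ≡ A
    transposedBlock = sum-cong-≗ (λ i → sum-cong-≗ (λ g → cong (λ d → δ d k) (New.lineDist-sym connected (newEdge i) (old′ g))))
    regroup : ∀ a b c → a + b + (b + c) ≡ a + 2 * b + c
    regroup = solve-∀

-- 2h = Λ − (m₀+5)(c₁ − 2c₀) and 2h₀ = Λ₀ − m₀(c₁ − 2c₀); subtract, substitute Λ − Λ₀, and
-- replace a₃ by x + c₃ − c₂.  Everything is moved to one side so that no subtraction occurs.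
annelation-arithmetic : ∀ h h₀ Λ Λ₀ m₀ (a : Fin 5 → ℕ) x k →
  2 * h + (m₀ + 5) * δ 1 k ≡ Λ + 2 * ((m₀ + 5) * δ 0 k) →
  2 * h₀ + m₀ * δ 1 k ≡ Λ₀ + 2 * (m₀ * δ 0 k) →
  Λ ≡ Λ₀ + 2 * ∑[ i < 5 ] a i + (13 * δ 1 k + 8 * δ 2 k + 4 * δ 3 k) →
  x + δ 3 k ≡ a 3F + δ 2 k →
  h ≡ h₀ + a 0F + a 2F + a 1F + a 4F + x + (5 * δ 0 k + 4 * δ 1 k + 3 * δ 2 k + 3 * δ 3 k)
annelation-arithmetic h h₀ Λ Λ₀ m₀ a x k hG h0 Λ≡ x≡ =
  *-cancelˡ-≡ h _ 2 (+-cancelʳ-≡ W (2 * h) _ chain)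
  where
  c₀ c₁ c₂ c₃ a₀ a₁ a₂ a₃ a₄ W rest : ℕ
  c₀ = δ 0 k
  c₁ = δ 1 k
  c₂ = δ 2 k
  c₃ = δ 3 k
  a₀ = a 0F
  a₁ = a 1F
  a₂ = a 2F
  a₃ = a 3F
  a₄ = a 4F
  W = (m₀ + 5) * c₁ + 2 * c₂
  rest = 2 * (a₀ + a₁ + a₂ + a₄) + 13 * c₁ + 8 * c₂ + 4 * c₃ + 10 * c₀
  open ≡-Reasoning
  chain : 2 * h + W ≡ 2 * (h₀ + a₀ + a₂ + a₁ + a₄ + x + (5 * c₀ + 4 * c₁ + 3 * c₂ + 3 * c₃)) + W
  chain = begin
    2 * h + ((m₀ + 5) * c₁ + 2 * c₂)          ≡⟨ +-assoc (2 * h) _ _ ⟨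
    2 * h + (m₀ + 5) * c₁ + 2 * c₂            ≡⟨ cong (_+ 2 * c₂) hG ⟩
    Λ + 2 * ((m₀ + 5) * c₀) + 2 * c₂          ≡⟨ cong (λ t → t + 2 * ((m₀ + 5) * c₀) + 2 * c₂) Λ≡ ⟩
    Λ₀ + 2 * (a₀ + (a₁ + (a₂ + (a₃ + (a₄ + 0))))) + (13 * c₁ + 8 * c₂ + 4 * c₃) + 2 * ((m₀ + 5) * c₀) + 2 * c₂
                                              ≡⟨ step₁ Λ₀ a₀ a₁ a₂ a₃ a₄ c₀ c₁ c₂ c₃ m₀ ⟩
    (Λ₀ + 2 * (m₀ * c₀)) + (2 * (a₃ + c₂) + rest)
                                              ≡⟨ cong₂ (λ t y → t + (2 * y + rest)) (sym h0) (sym x≡) ⟩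
    (2 * h₀ + m₀ * c₁) + (2 * (x + c₃) + rest) ≡⟨ step₂ h₀ a₀ a₁ a₂ a₄ x c₀ c₁ c₂ c₃ m₀ ⟩
    2 * (h₀ + a₀ + a₂ + a₁ + a₄ + x + (5 * c₀ + 4 * c₁ + 3 * c₂ + 3 * c₃)) + ((m₀ + 5) * c₁ + 2 * c₂) ∎
    where
    step₁ : ∀ Λ₀ a₀ a₁ a₂ a₃ a₄ c₀ c₁ c₂ c₃ m₀ →
      Λ₀ + 2 * (a₀ + (a₁ + (a₂ + (a₃ + (a₄ + 0))))) + (13 * c₁ + 8 * c₂ + 4 * c₃) + 2 * ((m₀ + 5) * c₀) + 2 * c₂
        ≡ (Λ₀ + 2 * (m₀ * c₀)) + (2 * (a₃ + c₂) + (2 * (a₀ + a₁ + a₂ + a₄) + 13 * c₁ + 8 * c₂ + 4 * c₃ + 10 * c₀))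
    step₁ = solve-∀
    step₂ : ∀ h₀ a₀ a₁ a₂ a₄ x c₀ c₁ c₂ c₃ m₀ →
      (2 * h₀ + m₀ * c₁) + (2 * (x + c₃) + (2 * (a₀ + a₁ + a₂ + a₄) + 13 * c₁ + 8 * c₂ + 4 * c₃ + 10 * c₀))
        ≡ 2 * (h₀ + a₀ + a₂ + a₁ + a₄ + x + (5 * c₀ + 4 * c₁ + 3 * c₂ + 3 * c₃)) + ((m₀ + 5) * c₁ + 2 * c₂)
    step₂ = solve-∀

fromList-5433 : ∀ k → fromList (5 ∷ 4 ∷ 3 ∷ 3 ∷ []) k ≡ 5 * δ 0 k + 4 * δ 1 k + 3 * δ 2 k + 3 * δ 3 k
fromList-5433 0 = refl
fromList-5433 1 = refl
fromList-5433 2 = refl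
fromList-5433 3 = refl
fromList-5433 (suc (suc (suc (suc k)))) = refl

theorem3p1 : (G₀ : Graph) → IsSimple G₀ → Connected G₀ → (e : Edge G₀) →
    let u = proj₁ (endpoints G₀ e)
        v = proj₂ (endpoints G₀ e)
        G = annelate6 G₀ u v
    in ∀ (k : ℕ) → He G k ≡
         (He G₀ ⊕ X* (HeV G₀ u) ⊕ X* (X* (HeV G₀ u))
                ⊕ X* (HeV G₀ v) ⊕ X* (X* (HeV G₀ v))
                ⊕ X* (X* (HeE G₀ e))
                ⊕ fromList (5 ∷ 4 ∷ 3 ∷ 3 ∷ [])) k
theorem3p1 G₀ simple₀ conn₀ e k = begin
  He G k
    ≡⟨ annelation-arithmetic (He G k) (He G₀ k) (New.lineDistPairs k) (Old.lineDistPairs k) m₀ (λ i → oldEdgesAt i k)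
         (X* (X* (HeE G₀ e)) k) k He-doubled-G (Old.He-doubled conn₀ k) (lineDistPairs-annelate k) (oldEdgesAt-qr k) ⟩
  He G₀ k + oldEdgesAt 0F k + oldEdgesAt 2F k + oldEdgesAt 1F k + oldEdgesAt 4F k + X* (X* (HeE G₀ e)) k
    + (5 * δ 0 k + 4 * δ 1 k + 3 * δ 2 k + 3 * δ 3 k)
    ≡⟨ cong₂ _+_ (cong (_+ X* (X* (HeE G₀ e)) k) (cong₂ _+_ (cong₂ _+_ (cong₂ _+_ (cong (He G₀ k +_)
         (oldEdgesAt-1+ 0F u lineDist-old-up k)) (oldEdgesAt-2+ 2F u lineDist-old-pq k))
         (oldEdgesAt-1+ 1F v lineDist-old-vs k)) (oldEdgesAt-2+ 4F v lineDist-old-rs k)))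
         (sym (fromList-5433 k)) ⟩
  (He G₀ ⊕ X* (HeV G₀ u) ⊕ X* (X* (HeV G₀ u)) ⊕ X* (HeV G₀ v) ⊕ X* (X* (HeV G₀ v))
         ⊕ X* (X* (HeE G₀ e)) ⊕ fromList (5 ∷ 4 ∷ 3 ∷ 3 ∷ [])) k ∎
  where
  open ≡-Reasoning
  open Annelation G₀ simple₀ conn₀ e
  He-doubled-G : 2 * He G k + (m₀ + 5) * δ 1 k ≡ New.lineDistPairs k + 2 * ((m₀ + 5) * δ 0 k)
  He-doubled-G = subst (λ m → 2 * He G k + m * δ 1 k ≡ New.lineDistPairs k + 2 * (m * δ 0 k))
                       edgeCount (New.He-doubled connected k)
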